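{- Let $z(n)$ be the number of zigzag stacks on $[n]$ for $n\ge1$, with $z(0)=1$, and let $Z(x)=\sum_{n\ge0}z(n)x^n$. Then $$x^2(x-1)Z^3(x)+2xZ^2(x)-(x+1)Z(x)+1=0.$$
   Context: $[n]=\{1,\dots,n\}$. A diagram on $[n]$ is a simple graph on vertex set $[n]$, vertices drawn in increasing order on a line; an edge $\{i,j\}$ with $i<j$ is an arc $(i,j)$. Arcs $(i_1,j_1),(i_2,j_2)$ cross if $i_1<i_2<j_1<j_2$; a stack is a diagram without crossing arcs. For a vertex $v$, $\mathrm{ld}(v)$ (resp. $\mathrm{rd}(v)$) is the number of arcs $(i,v)$ with $i<v$ (resp. $(v,j)$ with $j>v$), $\deg(v)=\mathrm{ld}(v)+\mathrm{rd}(v)$. A zigzag stack is a stack in which every vertex has degree at most $2$ and no vertex $v$ has both $\mathrm{ld}(v)>0$ and $\mathrm{rd}(v)>0$ (isolated vertices allowed). Identities are in the ring of formal power series. -}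

module Defs where

open import Data.Nat using (ℕ; zero; suc; _∸_; _<ᵇ_; _≡ᵇ_; _≤ᵇ_)
import Data.Nat as ℕ
open import Data.Bool using (Bool; true; false; _∧_; _∨_; not; if_then_else_)
open import Data.List using (List; []; _∷_; _++_; map; concatMap)
open import Data.Product using (_×_; _,_; proj₁; proj₂)
open import Data.Integer using (ℤ; +_) renaming (_+_ to _+ℤ_; _*_ to _*ℤ_; -_ to -ℤ_)

-- An arc (i , j) with i < j.
Arc : Set
Arc = ℕ × ℕ

range : ℕ → ℕ → List ℕ
range a zero    = []
range a (suc k) = a ∷ range (suc a) k

vertices : ℕ → List ℕ
vertices n = range 1 n

allArcs : ℕ → List Arc
allArcs n = concatMap (λ j → map (λ i → (i , j)) (range 1 (j ∸ 1))) (vertices n)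

subsets : {A : Set} → List A → List (List A)
subsets []       = [] ∷ []
subsets (x ∷ xs) = subsets xs ++ map (x ∷_) (subsets xs)

-- A diagram (simple graph) on [n] is a subset of allArcs n;
-- the diagrams on [n] are exactly the members of this list, without repetition.
diagrams : ℕ → List (List Arc)
diagrams n = subsets (allArcs n)

crossesᵇ : Arc → Arc → Bool
crossesᵇ (i₁ , j₁) (i₂ , j₂) = (i₁ <ᵇ i₂) ∧ (i₂ <ᵇ j₁) ∧ (j₁ <ᵇ j₂)

all : {A : Set} → (A → Bool) → List A → Bool
all p []       = true
all p (x ∷ xs) = p x ∧ all p xs

isStackᵇ : List Arc → Bool
isStackᵇ D = all (λ a → all (λ b → not (crossesᵇ a b)) D) D

count : {A : Set} → (A → Bool) → List A → ℕ
count p []       = 0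
count p (x ∷ xs) = if p x then suc (count p xs) else count p xs

ld : List Arc → ℕ → ℕ
ld D v = count (λ a → proj₂ a ≡ᵇ v) D

rd : List Arc → ℕ → ℕ
rd D v = count (λ a → proj₁ a ≡ᵇ v) D

deg : List Arc → ℕ → ℕ
deg D v = ld D v ℕ.+ rd D v

isZigzagStackᵇ : ℕ → List Arc → Bool
isZigzagStackᵇ n D =
  isStackᵇ D ∧
  all (λ v → (deg D v ≤ᵇ 2) ∧ not ((0 <ᵇ ld D v) ∧ (0 <ᵇ rd D v))) (vertices n)

z : ℕ → ℕ
z zero    = 1
z (suc n) = count (isZigzagStackᵇ (suc n)) (diagrams (suc n))

FPS : Set
FPS = ℕ → ℤ

infixl 6 _⊕_ _⊖_
infixl 7 _⊗_

_⊕_ : FPS → FPS → FPS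
(f ⊕ g) n = f n +ℤ g n

⊖_ : FPS → FPS
(⊖ f) n = -ℤ (f n)

_⊖_ : FPS → FPS → FPS
f ⊖ g = f ⊕ (⊖ g)

sumUpTo : (ℕ → ℤ) → ℕ → ℤ
sumUpTo h zero    = h 0
sumUpTo h (suc m) = sumUpTo h m +ℤ h (suc m)

_⊗_ : FPS → FPS → FPS
(f ⊗ g) n = sumUpTo (λ k → f k *ℤ g (n ∸ k)) n

const : ℤ → FPS
const c zero    = c
const c (suc n) = + 0

𝟘 𝟙 : FPS
𝟘 = const (+ 0)
𝟙 = const (+ 1)

X : FPS
X zero          = + 0
X (suc zero)    = + 1
X (suc (suc n)) = + 0

Zser : FPS
Zser n = + (z n)

module Submission where

-- Let zc c m count the zigzag stacks on [m] in which vertex 1 has degree at most c, and let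
-- Z, L, G be the generating functions for c = 2, 1, 0, so that Z is the series of the theorem.
-- The last vertex of a zigzag stack only has left arcs, and they start at no vertex, one vertex
-- i or two vertices i < k.  No arc passes over such an i or k, so the rest of the stack splits
-- into independent blocks [1, i), [i, k), [k, n] in which i and k have lost one unit of
-- capacity.  With P = L - 1 this gives
--   F = 1 + X F + X ((F - 1) P + Q) + X ((F - 1) P² + Q P)
-- for F = Z, L, G with Q = L - 1, G - 1, 0 respectively.  The equations for G and L are
-- contractions (D = X K D forces D = 0) whose solutions are G = 1 + X Z and
-- L = 1 + X Z L; eliminating L from the equation for Z leaves the cubic.

open import Defs
open import Data.Bool using (Bool; true; false; _∧_; _∨_; not; if_then_else_; T)
import Data.Bool.Properties as BP
open import Data.Nat as ℕ using (ℕ; zero; suc; _+_; _*_; _∸_; _≤_; _<_; z≤n; s≤s; _<ᵇ_; _≤ᵇ_; _≡ᵇ_)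
import Data.Nat.Properties as ℕP
import Data.Nat.Tactic.RingSolver as ℕSolver
open import Data.Integer as ℤ using (ℤ) renaming (_+_ to _+ℤ_; _*_ to _*ℤ_; -_ to -ℤ_)
import Data.Integer.Properties as ℤP
import Data.Integer.Tactic.RingSolver as ℤSolver
open import Data.List using (List; []; _∷_; _++_; map; length; concatMap; filterᵇ)
import Data.List.Properties as LP
open import Data.List.Relation.Unary.All as All using (All; []; _∷_)
import Data.List.Relation.Unary.All.Properties as AllP
open import Data.List.Relation.Unary.Any using (here; there)
open import Data.List.Membership.Propositional using (_∈_)
open import Data.Product using (_×_; _,_; proj₁; proj₂; ∃)
open import Data.Empty using (⊥-elim)
open import Data.Maybe using (Maybe; just; nothing)
open import Data.Unit using (tt)
open import Relation.Nullary using (¬_; yes; no)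
open import Relation.Nullary.Decidable using (T?)
open import Relation.Binary.Definitions using (tri<; tri≈; tri>)
open import Relation.Binary.Structures using (IsEquivalence)
open import Relation.Binary.PropositionalEquality
open import Function using (_∘_)
open import Algebra.Bundles using (CommutativeRing; CommutativeMonoid)
open import Algebra.Solver.Ring.AlmostCommutativeRing using (AlmostCommutativeRing; fromCommutativeRing; _-Raw-AlmostCommutative⟶_)
open import Algebra.Properties.CommutativeSemigroup (CommutativeMonoid.commutativeSemigroup BP.∧-commutativeMonoid)
  using () renaming (interchange to ∧-interchange; x∙yz≈y∙xz to ∧-left-comm)
open import Algebra.Properties.CommutativeSemigroup ℕP.+-commutativeSemigroup using () renaming (interchange to +-interchange)

T⇒≡true : ∀ {b} → T b → b ≡ true
T⇒≡true {true} _ = refl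

¬T⇒≡false : ∀ {b} → ¬ T b → b ≡ false
¬T⇒≡false {true} f = ⊥-elim (f tt)
¬T⇒≡false {false} _ = refl

≡true⇒T : ∀ {b} → b ≡ true → T b
≡true⇒T refl = tt

∧≡true⇒× : ∀ {a b} → a ∧ b ≡ true → a ≡ true × b ≡ true
∧≡true⇒× {true} {true} _ = refl , refl

Bool-≡-from-⇔ : ∀ {a b : Bool} → (a ≡ true → b ≡ true) → (b ≡ true → a ≡ true) → a ≡ b
Bool-≡-from-⇔ {true} {true} _ _ = refl
Bool-≡-from-⇔ {true} {false} f _ = sym (f refl)
Bool-≡-from-⇔ {false} {true} _ g = g refl
Bool-≡-from-⇔ {false} {false} _ _ = refl

<ᵇ-true : ∀ {a b} → a < b → (a <ᵇ b) ≡ true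
<ᵇ-true p = T⇒≡true (ℕP.<⇒<ᵇ p)

<ᵇ-false : ∀ {a b} → b ≤ a → (a <ᵇ b) ≡ false
<ᵇ-false {a} {b} p = ¬T⇒≡false (λ t → ℕP.<⇒≱ (ℕP.<ᵇ⇒< a b t) p)

≤ᵇ-true : ∀ {a b} → a ≤ b → (a ≤ᵇ b) ≡ true
≤ᵇ-true p = T⇒≡true (ℕP.≤⇒≤ᵇ p)

≤ᵇ-false : ∀ {a b} → b < a → (a ≤ᵇ b) ≡ false
≤ᵇ-false {a} {b} p = ¬T⇒≡false (λ t → ℕP.<⇒≱ p (ℕP.≤ᵇ⇒≤ a b t))

≡ᵇ-refl : ∀ a → (a ≡ᵇ a) ≡ true
≡ᵇ-refl a = T⇒≡true (ℕP.≡⇒≡ᵇ a a refl)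

≡ᵇ-false : ∀ {a b} → ¬ a ≡ b → (a ≡ᵇ b) ≡ false
≡ᵇ-false {a} {b} a≢b = ¬T⇒≡false (λ t → a≢b (ℕP.≡ᵇ⇒≡ a b t))

≡ᵇ-true⇒≡ : ∀ a b → (a ≡ᵇ b) ≡ true → a ≡ b
≡ᵇ-true⇒≡ a b e = ℕP.≡ᵇ⇒≡ a b (≡true⇒T e)

≤ᵇ-true⇒≤ : ∀ a b → (a ≤ᵇ b) ≡ true → a ≤ b
≤ᵇ-true⇒≤ a b e = ℕP.≤ᵇ⇒≤ a b (≡true⇒T e)

<ᵇ-true⇒< : ∀ a b → (a <ᵇ b) ≡ true → a < b
<ᵇ-true⇒< a b e = ℕP.<ᵇ⇒< a b (≡true⇒T e)

≤ᵇ≡not<ᵇ : ∀ i a → (i ≤ᵇ a) ≡ not (a <ᵇ i)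
≤ᵇ≡not<ᵇ i a with i ℕP.≤? a
... | yes i≤a = trans (≤ᵇ-true i≤a) (sym (cong not (<ᵇ-false i≤a)))
... | no i≰a = trans (≤ᵇ-false (ℕP.≰⇒> i≰a)) (sym (cong not (<ᵇ-true (ℕP.≰⇒> i≰a))))

all-++ : {A : Set} (p : A → Bool) (xs ys : List A) → all p (xs ++ ys) ≡ all p xs ∧ all p ys
all-++ p [] ys = refl
all-++ p (x ∷ xs) ys = trans (cong (p x ∧_) (all-++ p xs ys)) (sym (BP.∧-assoc (p x) _ _))

all-cong : {A : Set} {p q : A → Bool} {xs : List A} → All (λ x → p x ≡ q x) xs → all p xs ≡ all q xs
all-cong [] = refl
all-cong (e ∷ es) = cong₂ _∧_ e (all-cong es)

all-cong′ : {A : Set} {p q : A → Bool} (xs : List A) → (∀ x → p x ≡ q x) → all p xs ≡ all q xs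
all-cong′ xs e = all-cong (All.tabulate {xs = xs} (λ {x} _ → e x))

All⇒all : {A : Set} {p : A → Bool} {xs : List A} → All (λ x → p x ≡ true) xs → all p xs ≡ true
All⇒all [] = refl
All⇒all (e ∷ es) rewrite e = All⇒all es

all⇒All : {A : Set} (p : A → Bool) (xs : List A) → all p xs ≡ true → All (λ x → p x ≡ true) xs
all⇒All p [] _ = []
all⇒All p (x ∷ xs) e = proj₁ (∧≡true⇒× e) ∷ all⇒All p xs (proj₂ (∧≡true⇒× e))

all-∧ : {A : Set} (p q : A → Bool) (xs : List A) → all (λ x → p x ∧ q x) xs ≡ all p xs ∧ all q xs
all-∧ p q [] = refl
all-∧ p q (x ∷ xs) rewrite all-∧ p q xs = ∧-interchange (p x) (q x) (all p xs) (all q xs)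

all-map : {A B : Set} (p : B → Bool) (f : A → B) (xs : List A) → all p (map f xs) ≡ all (p ∘ f) xs
all-map p f [] = refl
all-map p f (x ∷ xs) = cong (p (f x) ∧_) (all-map p f xs)

all-swap : {A B : Set} (q : A → B → Bool) (xs : List A) (ys : List B) →
  all (λ a → all (q a) ys) xs ≡ all (λ b → all (λ a → q a b) xs) ys
all-swap q [] ys = sym (All⇒all {xs = ys} (All.tabulate (λ _ → refl)))
all-swap q (x ∷ xs) ys = trans (cong (all (q x) ys ∧_) (all-swap q xs ys))
  (sym (all-∧ (q x) (λ b → all (λ a → q a b) xs) ys))

all-false : {A : Set} (p : A → Bool) {x : A} {xs : List A} → x ∈ xs → p x ≡ false → all p xs ≡ false
all-false p (here refl) e rewrite e = refl
all-false p {xs = y ∷ xs} (there m) e = trans (cong (p y ∧_) (all-false p m e)) (BP.∧-zeroʳ (p y))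

all-filter-split : {A : Set} (p c : A → Bool) (xs : List A) →
  all p xs ≡ all p (filterᵇ c xs) ∧ all p (filterᵇ (not ∘ c) xs)
all-filter-split p c [] = refl
all-filter-split p c (x ∷ xs) with c x
... | true = trans (cong (p x ∧_) (all-filter-split p c xs)) (sym (BP.∧-assoc (p x) _ _))
... | false = trans (cong (p x ∧_) (all-filter-split p c xs)) (∧-left-comm (p x) (all p (filterᵇ c xs)) _)

count-++ : {A : Set} (p : A → Bool) (xs ys : List A) → count p (xs ++ ys) ≡ count p xs + count p ys
count-++ p [] ys = refl
count-++ p (x ∷ xs) ys with p x
... | true = cong suc (count-++ p xs ys)
... | false = count-++ p xs ys

count-map : {A B : Set} (p : B → Bool) (f : A → B) (xs : List A) → count p (map f xs) ≡ count (p ∘ f) xs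
count-map p f [] = refl
count-map p f (x ∷ xs) with p (f x)
... | true = cong suc (count-map p f xs)
... | false = count-map p f xs

count-cong : {A : Set} {p q : A → Bool} (xs : List A) → (∀ x → p x ≡ q x) → count p xs ≡ count q xs
count-cong [] e = refl
count-cong {q = q} (x ∷ xs) e rewrite e x with q x
... | true = cong suc (count-cong xs e)
... | false = count-cong xs e

count-false : {A : Set} (xs : List A) → count (λ _ → false) xs ≡ 0
count-false [] = refl
count-false (x ∷ xs) = count-false xs

count-true : {A : Set} (xs : List A) → count (λ _ → true) xs ≡ length xs
count-true [] = refl
count-true (x ∷ xs) = cong suc (count-true xs)

count-none : {A : Set} {q : A → Bool} {xs : List A} → All (λ x → q x ≡ false) xs → count q xs ≡ 0
count-none [] = refl
count-none {q = q} {x ∷ xs} (e ∷ es) rewrite e = count-none es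

count≡ᵇ0 : {A : Set} (q : A → Bool) (xs : List A) → (count q xs ≡ᵇ 0) ≡ all (not ∘ q) xs
count≡ᵇ0 q [] = refl
count≡ᵇ0 q (x ∷ xs) with q x
... | true = refl
... | false = count≡ᵇ0 q xs

count-pos : {A : Set} (q : A → Bool) {x : A} {xs : List A} → x ∈ xs → q x ≡ true → 1 ≤ count q xs
count-pos q {xs = y ∷ xs} (here refl) e rewrite e = s≤s z≤n
count-pos q {xs = y ∷ xs} (there m) e with q y
... | true = s≤s z≤n
... | false = count-pos q m e

count-pos⁻ : {A : Set} (q : A → Bool) (xs : List A) → 1 ≤ count q xs → ∃ λ x → x ∈ xs × q x ≡ true
count-pos⁻ q (y ∷ xs) p with q y in e
... | true = y , here refl , e
... | false with count-pos⁻ q xs p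
... | x , m , e′ = x , there m , e′

count-filter-split : {A : Set} (q c : A → Bool) (xs : List A) →
  count q xs ≡ count q (filterᵇ c xs) + count q (filterᵇ (not ∘ c) xs)
count-filter-split q c [] = refl
count-filter-split q c (x ∷ xs) with c x
... | true with q x
...   | true = cong suc (count-filter-split q c xs)
...   | false = count-filter-split q c xs
count-filter-split q c (x ∷ xs) | false with q x
...   | true = trans (cong suc (count-filter-split q c xs)) (sym (ℕP.+-suc _ _))
...   | false = count-filter-split q c xs

indicator : Bool → ℕ
indicator true = 1
indicator false = 0

count-const-∧ : {A : Set} (b : Bool) (p : A → Bool) (xs : List A) →
  count (λ x → b ∧ p x) xs ≡ indicator b * count p xs
count-const-∧ true p xs = sym (ℕP.+-identityʳ _)
count-const-∧ false p xs = count-false xs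

filterᵇ-cong : {A : Set} {c d : A → Bool} {xs : List A} → All (λ x → c x ≡ d x) xs → filterᵇ c xs ≡ filterᵇ d xs
filterᵇ-cong [] = refl
filterᵇ-cong {d = d} {x ∷ xs} (e ∷ es) rewrite e with d x
... | true = cong (x ∷_) (filterᵇ-cong es)
... | false = filterᵇ-cong es

All-filterᵇ : {A : Set} {P : A → Set} (c : A → Bool) {xs : List A} → All P xs → All P (filterᵇ c xs)
All-filterᵇ c [] = []
All-filterᵇ c {x ∷ xs} (px ∷ ps) with c x
... | true = px ∷ All-filterᵇ c ps
... | false = All-filterᵇ c ps

filterᵇ-satisfies : {A : Set} (c : A → Bool) (xs : List A) → All (λ x → c x ≡ true) (filterᵇ c xs)
filterᵇ-satisfies c [] = []
filterᵇ-satisfies c (x ∷ xs) with c x in e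
... | true = e ∷ filterᵇ-satisfies c xs
... | false = filterᵇ-satisfies c xs

filterᵇ-all : {A : Set} {c : A → Bool} {xs : List A} → All (λ x → c x ≡ true) xs → filterᵇ c xs ≡ xs
filterᵇ-all [] = refl
filterᵇ-all {c = c} {x ∷ xs} (e ∷ es) rewrite e = cong (x ∷_) (filterᵇ-all es)

filterᵇ-none : {A : Set} {c : A → Bool} {xs : List A} → All (λ x → c x ≡ false) xs → filterᵇ c xs ≡ []
filterᵇ-none [] = refl
filterᵇ-none {c = c} {x ∷ xs} (e ∷ es) rewrite e = filterᵇ-none es

filterᵇ-++ : {A : Set} (c : A → Bool) (xs ys : List A) → filterᵇ c (xs ++ ys) ≡ filterᵇ c xs ++ filterᵇ c ys
filterᵇ-++ c = LP.filter-++ (T? ∘ c)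

filterᵇ-concatMap : {A B : Set} (c : B → Bool) (g : A → List B) (xs : List A) →
  filterᵇ c (concatMap g xs) ≡ concatMap (filterᵇ c ∘ g) xs
filterᵇ-concatMap c g [] = refl
filterᵇ-concatMap c g (x ∷ xs) = trans (filterᵇ-++ c (g x) _) (cong (filterᵇ c (g x) ++_) (filterᵇ-concatMap c g xs))

concatMap-cong-All : {A B : Set} {f g : A → List B} {xs : List A} → All (λ x → f x ≡ g x) xs →
  concatMap f xs ≡ concatMap g xs
concatMap-cong-All [] = refl
concatMap-cong-All (e ∷ es) = cong₂ _++_ e (concatMap-cong-All es)

sumBy : {A : Set} → (A → ℕ) → List A → ℕ
sumBy f [] = 0
sumBy f (x ∷ xs) = f x + sumBy f xs

sumBy-++ : {A : Set} (f : A → ℕ) (xs ys : List A) → sumBy f (xs ++ ys) ≡ sumBy f xs + sumBy f ys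
sumBy-++ f [] ys = refl
sumBy-++ f (x ∷ xs) ys = trans (cong (f x +_) (sumBy-++ f xs ys)) (sym (ℕP.+-assoc (f x) _ _))

sumBy-map : {A B : Set} (f : B → ℕ) (g : A → B) (xs : List A) → sumBy f (map g xs) ≡ sumBy (f ∘ g) xs
sumBy-map f g [] = refl
sumBy-map f g (x ∷ xs) = cong (f (g x) +_) (sumBy-map f g xs)

sumBy-+ : {A : Set} (f g : A → ℕ) (xs : List A) → sumBy (λ x → f x + g x) xs ≡ sumBy f xs + sumBy g xs
sumBy-+ f g [] = refl
sumBy-+ f g (x ∷ xs) = trans (cong (f x + g x +_) (sumBy-+ f g xs)) (+-interchange (f x) (g x) _ _)

sumBy-cong : {A : Set} {f g : A → ℕ} {xs : List A} → All (λ x → f x ≡ g x) xs → sumBy f xs ≡ sumBy g xs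
sumBy-cong [] = refl
sumBy-cong (e ∷ es) = cong₂ _+_ e (sumBy-cong es)

sumBy-cong′ : {A : Set} {f g : A → ℕ} (xs : List A) → (∀ x → f x ≡ g x) → sumBy f xs ≡ sumBy g xs
sumBy-cong′ xs e = sumBy-cong (All.tabulate {xs = xs} (λ {x} _ → e x))

sumBy-zero : {A : Set} (f : A → ℕ) (xs : List A) → (∀ x → f x ≡ 0) → sumBy f xs ≡ 0
sumBy-zero f [] e = refl
sumBy-zero f (x ∷ xs) e = cong₂ _+_ (e x) (sumBy-zero f xs e)

sumBy-*ˡ : {A : Set} (c : ℕ) (f : A → ℕ) (xs : List A) → sumBy (λ x → c * f x) xs ≡ c * sumBy f xs
sumBy-*ˡ c f [] = sym (ℕP.*-zeroʳ c)
sumBy-*ˡ c f (x ∷ xs) = trans (cong (c * f x +_) (sumBy-*ˡ c f xs)) (sym (ℕP.*-distribˡ-+ c (f x) _))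

subsets-map : {A B : Set} (f : A → B) (xs : List A) → subsets (map f xs) ≡ map (map f) (subsets xs)
subsets-map f [] = refl
subsets-map f (x ∷ xs) rewrite subsets-map f xs =
  trans (cong (map (map f) (subsets xs) ++_) (trans (sym (LP.map-∘ (subsets xs))) (LP.map-∘ (subsets xs))))
        (sym (LP.map-++ (map f) (subsets xs) (map (x ∷_) (subsets xs))))

count-subsets-cons : {A : Set} (p : List A → Bool) (x : A) (xs : List A) →
  count p (subsets (x ∷ xs)) ≡ count p (subsets xs) + count (p ∘ (x ∷_)) (subsets xs)
count-subsets-cons p x xs = trans (count-++ p (subsets xs) (map (x ∷_) (subsets xs)))
  (cong (count p (subsets xs) +_) (count-map p (x ∷_) (subsets xs)))

count≡sumBy-indicator : {A : Set} (p : A → Bool) (xs : List A) → count p xs ≡ sumBy (indicator ∘ p) xs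
count≡sumBy-indicator p [] = refl
count≡sumBy-indicator p (x ∷ xs) with p x
... | true = cong suc (count≡sumBy-indicator p xs)
... | false = count≡sumBy-indicator p xs

count-subsets-++ : {A : Set} (p : List A → Bool) (xs ys : List A) →
  count p (subsets (xs ++ ys)) ≡ sumBy (λ T → count (λ S → p (S ++ T)) (subsets xs)) (subsets ys)
count-subsets-++ p [] ys = trans (count≡sumBy-indicator p (subsets ys)) (sumBy-cong′ (subsets ys) singleton)
  where
  singleton : ∀ T → indicator (p T) ≡ count (λ S → p (S ++ T)) ([] ∷ [])
  singleton T with p T
  ... | true = refl
  ... | false = refl
count-subsets-++ p (x ∷ xs) ys = begin
  count p (subsets (x ∷ xs ++ ys))
    ≡⟨ count-subsets-cons p x (xs ++ ys) ⟩
  count p (subsets (xs ++ ys)) + count (p ∘ (x ∷_)) (subsets (xs ++ ys))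
    ≡⟨ cong₂ _+_ (count-subsets-++ p xs ys) (count-subsets-++ (p ∘ (x ∷_)) xs ys) ⟩
  sumBy (λ T → count (λ S → p (S ++ T)) (subsets xs)) (subsets ys)
    + sumBy (λ T → count (λ S → p (x ∷ S ++ T)) (subsets xs)) (subsets ys)
    ≡⟨ sym (sumBy-+ _ _ (subsets ys)) ⟩
  sumBy (λ T → count (λ S → p (S ++ T)) (subsets xs) + count (λ S → p (x ∷ S ++ T)) (subsets xs)) (subsets ys)
    ≡⟨ sumBy-cong′ (subsets ys) (λ T → sym (count-subsets-cons (λ S → p (S ++ T)) x xs)) ⟩
  sumBy (λ T → count (λ S → p (S ++ T)) (subsets (x ∷ xs))) (subsets ys) ∎
  where open ≡-Reasoning

count-subsets-cong : {A : Set} {Q : A → Set} {p q : List A → Bool} (xs : List A) → All Q xs →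
  (∀ S → All Q S → p S ≡ q S) → count p (subsets xs) ≡ count q (subsets xs)
count-subsets-cong {A = A} [] _ e = cong (λ b → count {A = List A} (λ _ → b) ([] ∷ [])) (e [] [])
count-subsets-cong {p = p} {q} (x ∷ xs) (qx ∷ qxs) e = begin
  count p (subsets (x ∷ xs))
    ≡⟨ count-subsets-cons p x xs ⟩
  count p (subsets xs) + count (p ∘ (x ∷_)) (subsets xs)
    ≡⟨ cong₂ _+_ (count-subsets-cong xs qxs e) (count-subsets-cong xs qxs (λ S qS → e (x ∷ S) (qx ∷ qS))) ⟩
  count q (subsets xs) + count (q ∘ (x ∷_)) (subsets xs)
    ≡⟨ sym (count-subsets-cons q x xs) ⟩
  count q (subsets (x ∷ xs)) ∎
  where open ≡-Reasoning

splitsAs : {A : Set} (isA isB : A → Bool) (g h : List A → Bool) → List A → Bool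
splitsAs isA isB g h S = all (λ x → isA x ∨ isB x) S ∧ g (filterᵇ isA S) ∧ h (filterᵇ isB S)

count-subsets-splitsAs : {A : Set} (isA isB : A → Bool) (g h : List A → Bool) (L : List A) →
  All (λ x → isA x ∧ isB x ≡ false) L →
  count (splitsAs isA isB g h) (subsets L) ≡ count g (subsets (filterᵇ isA L)) * count h (subsets (filterᵇ isB L))
count-subsets-splitsAs isA isB g h [] [] with g [] | h []
... | true | true = refl
... | true | false = refl
... | false | _ = refl
count-subsets-splitsAs {A} isA isB g h (x ∷ L) (disjoint ∷ ds) with isA x in ea | isB x in eb
count-subsets-splitsAs isA isB g h (x ∷ L) (() ∷ _) | true | true
... | true | false = begin
  count P (subsets (x ∷ L))
    ≡⟨ count-subsets-cons P x L ⟩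
  count P (subsets L) + count (P ∘ (x ∷_)) (subsets L)
    ≡⟨ cong (count P (subsets L) +_) (count-cong (subsets L) step) ⟩
  count P (subsets L) + count (splitsAs isA isB (g ∘ (x ∷_)) h) (subsets L)
    ≡⟨ cong₂ _+_ (count-subsets-splitsAs isA isB g h L ds) (count-subsets-splitsAs isA isB (g ∘ (x ∷_)) h L ds) ⟩
  cg * ch + count (g ∘ (x ∷_)) (subsets (filterᵇ isA L)) * ch
    ≡⟨ sym (ℕP.*-distribʳ-+ ch cg _) ⟩
  (cg + count (g ∘ (x ∷_)) (subsets (filterᵇ isA L))) * ch
    ≡⟨ cong (_* ch) (sym (count-subsets-cons g x (filterᵇ isA L))) ⟩
  count g (subsets (x ∷ filterᵇ isA L)) * ch ∎
  where
  open ≡-Reasoning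
  P : List A → Bool
  P = splitsAs isA isB g h
  cg ch : ℕ
  cg = count g (subsets (filterᵇ isA L))
  ch = count h (subsets (filterᵇ isB L))
  step : ∀ S → P (x ∷ S) ≡ splitsAs isA isB (g ∘ (x ∷_)) h S
  step S rewrite ea | eb = refl
... | false | true = begin
  count P (subsets (x ∷ L))
    ≡⟨ count-subsets-cons P x L ⟩
  count P (subsets L) + count (P ∘ (x ∷_)) (subsets L)
    ≡⟨ cong (count P (subsets L) +_) (count-cong (subsets L) step) ⟩
  count P (subsets L) + count (splitsAs isA isB g (h ∘ (x ∷_))) (subsets L)
    ≡⟨ cong₂ _+_ (count-subsets-splitsAs isA isB g h L ds) (count-subsets-splitsAs isA isB g (h ∘ (x ∷_)) L ds) ⟩
  cg * ch + cg * count (h ∘ (x ∷_)) (subsets (filterᵇ isB L))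
    ≡⟨ sym (ℕP.*-distribˡ-+ cg ch _) ⟩
  cg * (ch + count (h ∘ (x ∷_)) (subsets (filterᵇ isB L)))
    ≡⟨ cong (cg *_) (sym (count-subsets-cons h x (filterᵇ isB L))) ⟩
  cg * count h (subsets (x ∷ filterᵇ isB L)) ∎
  where
  open ≡-Reasoning
  P : List A → Bool
  P = splitsAs isA isB g h
  cg ch : ℕ
  cg = count g (subsets (filterᵇ isA L))
  ch = count h (subsets (filterᵇ isB L))
  step : ∀ S → P (x ∷ S) ≡ splitsAs isA isB g (h ∘ (x ∷_)) S
  step S rewrite ea | eb = refl
... | false | false = begin
  count P (subsets (x ∷ L))
    ≡⟨ count-subsets-cons P x L ⟩
  count P (subsets L) + count (P ∘ (x ∷_)) (subsets L)
    ≡⟨ cong (count P (subsets L) +_) (trans (count-cong (subsets L) step) (count-false (subsets L))) ⟩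
  count P (subsets L) + 0
    ≡⟨ ℕP.+-identityʳ _ ⟩
  count P (subsets L)
    ≡⟨ count-subsets-splitsAs isA isB g h L ds ⟩
  count g (subsets (filterᵇ isA L)) * count h (subsets (filterᵇ isB L)) ∎
  where
  open ≡-Reasoning
  P : List A → Bool
  P = splitsAs isA isB g h
  step : ∀ S → P (x ∷ S) ≡ false
  step S rewrite ea | eb = refl

sumSingletons : {A : Set} → (List A → ℕ) → List A → ℕ
sumSingletons f xs = sumBy (λ x → f (x ∷ [])) xs

sumPairs : {A : Set} → (List A → ℕ) → List A → ℕ
sumPairs f [] = 0
sumPairs f (x ∷ xs) = sumBy (λ y → f (x ∷ y ∷ [])) xs + sumPairs f xs

sumPairs-zero : {A : Set} (g : List A → ℕ) → (∀ y z → g (y ∷ z ∷ []) ≡ 0) → ∀ xs → sumPairs g xs ≡ 0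
sumPairs-zero g e [] = refl
sumPairs-zero g e (x ∷ xs) = cong₂ _+_ (sumBy-zero _ xs (e x)) (sumPairs-zero g e xs)

sumBy-subsets-atMostPairs : {A : Set} (f : List A → ℕ) → (∀ a b c I → f (a ∷ b ∷ c ∷ I) ≡ 0) → ∀ xs →
  sumBy f (subsets xs) ≡ f [] + sumSingletons f xs + sumPairs f xs
sumBy-subsets-atMostPairs f v [] = sym (ℕP.+-identityʳ (f [] + 0))
sumBy-subsets-atMostPairs f v (x ∷ xs) = begin
  sumBy f (subsets xs ++ map (x ∷_) (subsets xs))
    ≡⟨ trans (sumBy-++ f (subsets xs) _) (cong (sumBy f (subsets xs) +_) (sumBy-map f (x ∷_) (subsets xs))) ⟩
  sumBy f (subsets xs) + sumBy (f ∘ (x ∷_)) (subsets xs)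
    ≡⟨ cong₂ _+_ (sumBy-subsets-atMostPairs f v xs)
                 (sumBy-subsets-atMostPairs (f ∘ (x ∷_)) (λ a b c I → v x a b (c ∷ I)) xs) ⟩
  (f [] + sumSingletons f xs + sumPairs f xs) + (f (x ∷ []) + sumSingletons (f ∘ (x ∷_)) xs + sumPairs (f ∘ (x ∷_)) xs)
    ≡⟨ cong (λ t → (f [] + sumSingletons f xs + sumPairs f xs) + (f (x ∷ []) + sumSingletons (f ∘ (x ∷_)) xs + t))
            (sumPairs-zero (f ∘ (x ∷_)) (λ y z → v x y z []) xs) ⟩
  (f [] + sumSingletons f xs + sumPairs f xs) + (f (x ∷ []) + sumSingletons (f ∘ (x ∷_)) xs + 0)
    ≡⟨ regroup (f []) (sumSingletons f xs) (sumPairs f xs) (f (x ∷ [])) (sumSingletons (f ∘ (x ∷_)) xs) ⟩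
  f [] + (f (x ∷ []) + sumSingletons f xs) + (sumSingletons (f ∘ (x ∷_)) xs + sumPairs f xs) ∎
  where
  open ≡-Reasoning
  regroup : ∀ a b c d e → (a + b + c) + (d + e + 0) ≡ a + (d + b) + (e + c)
  regroup = ℕSolver.solve-∀

range-++ : ∀ a m₁ m₂ → range a (m₁ + m₂) ≡ range a m₁ ++ range (a + m₁) m₂
range-++ a zero m₂ = cong (λ t → range t m₂) (sym (ℕP.+-identityʳ a))
range-++ a (suc m₁) m₂ = cong (a ∷_) (trans (range-++ (suc a) m₁ m₂) (cong (λ t → range (suc a) m₁ ++ range t m₂) (sym (ℕP.+-suc a m₁))))

range-snoc : ∀ a m → range a (suc m) ≡ range a m ++ (a + m) ∷ []
range-snoc a m = trans (cong (range a) (ℕP.+-comm 1 m)) (range-++ a m 1)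

All-range : ∀ a m → All (λ v → a ≤ v × v < a + m) (range a m)
All-range a zero = []
All-range a (suc m) = (ℕP.≤-refl , subst (a <_) (sym (ℕP.+-suc a m)) (s≤s (ℕP.m≤m+n a m)))
  ∷ All.map (λ {v} (a<v , v<) → ℕP.<⇒≤ a<v , subst (v <_) (sym (ℕP.+-suc a m)) v<) (All-range (suc a) m)

∈-range : ∀ a m i → a ≤ i → i < a + m → i ∈ range a m
∈-range a zero i a≤i i< = ⊥-elim (ℕP.<⇒≱ i< (subst (_≤ i) (sym (ℕP.+-identityʳ a)) a≤i))
∈-range a (suc m) i a≤i i< with ℕP.<-cmp a i
... | tri≈ _ refl _ = here refl
... | tri< a<i _ _ = there (∈-range (suc a) m i a<i (subst (i <_) (ℕP.+-suc a m) i<))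
... | tri> _ _ a>i = ⊥-elim (ℕP.<⇒≱ a>i a≤i)

range-shift : ∀ b a m → range (b + a) m ≡ map (_+ a) (range b m)
range-shift b a zero = refl
range-shift b a (suc m) = cong ((b + a) ∷_) (range-shift (suc b) a m)

range-suc : ∀ b m → range (suc b) m ≡ map suc (range b m)
range-suc b zero = refl
range-suc b (suc m) = cong (suc b ∷_) (range-suc (suc b) m)

arcsEndingAt : ℕ → ℕ → List Arc
arcsEndingAt a j = map (λ i → (i , j)) (range a (j ∸ a))

-- All arcs with both ends in [a, a + m); allArcs n is arcsOn 1 n by definition.
arcsOn : ℕ → ℕ → List Arc
arcsOn a m = concatMap (arcsEndingAt a) (range a m)

ArcOn : ℕ → ℕ → Arc → Set
ArcOn a m x = a ≤ proj₁ x × proj₁ x < proj₂ x × proj₂ x < a + m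

allArcs-suc : ∀ n → allArcs (suc n) ≡ allArcs n ++ map (λ i → (i , suc n)) (range 1 n)
allArcs-suc n = trans (cong (concatMap (arcsEndingAt 1)) (range-snoc 1 n))
  (trans (LP.concatMap-++ (arcsEndingAt 1) (range 1 n) (suc n ∷ [])) (cong (allArcs n ++_) (LP.++-identityʳ _)))

All-arcsEndingAt : ∀ a j → All (λ x → a ≤ proj₁ x × proj₁ x < proj₂ x × proj₂ x ≡ j) (arcsEndingAt a j)
All-arcsEndingAt a j = AllP.map⁺ (All.map (λ {i} (a≤i , i<) → a≤i , subst (i <_) (ℕP.m+[n∸m]≡n (a≤j i a≤i i<)) i< , refl) (All-range a (j ∸ a)))
  where
  a≤j : ∀ i → a ≤ i → i < a + (j ∸ a) → a ≤ j
  a≤j i a≤i i< with a ℕP.≤? j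
  ... | yes a≤j = a≤j
  ... | no a≰j = ⊥-elim (ℕP.<⇒≱ (subst (i <_) (trans (cong (a +_) (ℕP.m≤n⇒m∸n≡0 (ℕP.<⇒≤ (ℕP.≰⇒> a≰j)))) (ℕP.+-identityʳ a)) i<) a≤i)

All-arcsOn : ∀ a m → All (ArcOn a m) (arcsOn a m)
All-arcsOn a m = AllP.concat⁺ (AllP.map⁺ (All.map (λ {j} (_ , j<) → All.map (λ (a≤ , lt , e) → a≤ , lt , subst (_< a + m) (sym e) j<)
    (All-arcsEndingAt a j)) (All-range a m)))

endsBefore : ℕ → Arc → Bool
endsBefore p a = proj₂ a <ᵇ p

startsFrom : ℕ → Arc → Bool
startsFrom p a = p ≤ᵇ proj₁ a

endsBefore∧startsFrom : ∀ p (x : Arc) → proj₁ x < proj₂ x → endsBefore p x ∧ startsFrom p x ≡ false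
endsBefore∧startsFrom p (x₁ , x₂) lt with x₂ <ᵇ p in e
... | true = ≤ᵇ-false (ℕP.<-trans lt (<ᵇ-true⇒< x₂ p e))
... | false = refl

filter-endsBefore-arcsOn : ∀ lo m₁ m₂ → filterᵇ (endsBefore (lo + m₁)) (arcsOn lo (m₁ + m₂)) ≡ arcsOn lo m₁
filter-endsBefore-arcsOn lo m₁ m₂ = begin
  filterᵇ (endsBefore p) (concatMap (arcsEndingAt lo) (range lo (m₁ + m₂)))
    ≡⟨ cong (filterᵇ (endsBefore p)) (trans (cong (concatMap (arcsEndingAt lo)) (range-++ lo m₁ m₂))
        (LP.concatMap-++ (arcsEndingAt lo) (range lo m₁) (range p m₂))) ⟩
  filterᵇ (endsBefore p) (arcsOn lo m₁ ++ concatMap (arcsEndingAt lo) (range p m₂))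
    ≡⟨ filterᵇ-++ (endsBefore p) (arcsOn lo m₁) _ ⟩
  filterᵇ (endsBefore p) (arcsOn lo m₁) ++ filterᵇ (endsBefore p) (concatMap (arcsEndingAt lo) (range p m₂))
    ≡⟨ cong₂ _++_ (filterᵇ-all (All.map (λ (_ , _ , x₂<) → <ᵇ-true x₂<) (All-arcsOn lo m₁)))
                  (filterᵇ-none (AllP.concat⁺ (AllP.map⁺ (All.map
                      (λ {j} (p≤j , _) → All.map (λ (_ , _ , e) → <ᵇ-false (subst (p ≤_) (sym e) p≤j)) (All-arcsEndingAt lo j)) (All-range p m₂))))) ⟩
  arcsOn lo m₁ ++ []
    ≡⟨ LP.++-identityʳ _ ⟩
  arcsOn lo m₁ ∎
  where
  open ≡-Reasoning
  p : ℕ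
  p = lo + m₁

filter-startsFrom-arcsEndingAt : ∀ lo m₁ j → lo + m₁ ≤ j →
  filterᵇ (startsFrom (lo + m₁)) (arcsEndingAt lo j) ≡ arcsEndingAt (lo + m₁) j
filter-startsFrom-arcsEndingAt lo m₁ j p≤j = begin
  filterᵇ (startsFrom p) (map arc (range lo (j ∸ lo)))
    ≡⟨ cong (λ t → filterᵇ (startsFrom p) (map arc t)) (trans (cong (range lo) j∸lo) (range-++ lo m₁ (j ∸ p))) ⟩
  filterᵇ (startsFrom p) (map arc (range lo m₁ ++ range p (j ∸ p)))
    ≡⟨ trans (cong (filterᵇ (startsFrom p)) (LP.map-++ arc (range lo m₁) _)) (filterᵇ-++ (startsFrom p) (map arc (range lo m₁)) _) ⟩
  filterᵇ (startsFrom p) (map arc (range lo m₁)) ++ filterᵇ (startsFrom p) (map arc (range p (j ∸ p)))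
    ≡⟨ cong₂ _++_ (filterᵇ-none (AllP.map⁺ (All.map (λ (_ , i<p) → ≤ᵇ-false i<p) (All-range lo m₁))))
                  (filterᵇ-all (AllP.map⁺ (All.map (λ (p≤i , _) → ≤ᵇ-true p≤i) (All-range p (j ∸ p))))) ⟩
  arcsEndingAt p j ∎
  where
  open ≡-Reasoning
  p : ℕ
  p = lo + m₁
  arc : ℕ → Arc
  arc i = (i , j)
  j∸lo : j ∸ lo ≡ m₁ + (j ∸ p)
  j∸lo = trans (cong (_∸ lo) (sym (ℕP.m+[n∸m]≡n p≤j))) (trans (cong (_∸ lo) (ℕP.+-assoc lo m₁ (j ∸ p))) (ℕP.m+n∸m≡n lo (m₁ + (j ∸ p))))

filter-startsFrom-arcsOn : ∀ lo m₁ m₂ → filterᵇ (startsFrom (lo + m₁)) (arcsOn lo (m₁ + m₂)) ≡ arcsOn (lo + m₁) m₂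
filter-startsFrom-arcsOn lo m₁ m₂ = begin
  filterᵇ (startsFrom p) (concatMap (arcsEndingAt lo) (range lo (m₁ + m₂)))
    ≡⟨ cong (filterᵇ (startsFrom p)) (trans (cong (concatMap (arcsEndingAt lo)) (range-++ lo m₁ m₂))
        (LP.concatMap-++ (arcsEndingAt lo) (range lo m₁) (range p m₂))) ⟩
  filterᵇ (startsFrom p) (arcsOn lo m₁ ++ concatMap (arcsEndingAt lo) (range p m₂))
    ≡⟨ filterᵇ-++ (startsFrom p) (arcsOn lo m₁) _ ⟩
  filterᵇ (startsFrom p) (arcsOn lo m₁) ++ filterᵇ (startsFrom p) (concatMap (arcsEndingAt lo) (range p m₂))
    ≡⟨ cong₂ _++_ (filterᵇ-none (All.map (λ (_ , lt , x₂<) → ≤ᵇ-false (ℕP.<-trans lt x₂<)) (All-arcsOn lo m₁)))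
                  (trans (filterᵇ-concatMap (startsFrom p) (arcsEndingAt lo) (range p m₂))
                         (concatMap-cong-All (All.map (λ {j} (p≤j , _) → filter-startsFrom-arcsEndingAt lo m₁ j p≤j) (All-range p m₂)))) ⟩
  arcsOn p m₂ ∎
  where
  open ≡-Reasoning
  p : ℕ
  p = lo + m₁

shiftArc : ℕ → Arc → Arc
shiftArc a (x , y) = (x + a , y + a)

arcsOn-shift : ∀ a m → arcsOn (suc a) m ≡ map (shiftArc a) (arcsOn 1 m)
arcsOn-shift a m = begin
  concatMap (arcsEndingAt (suc a)) (range (1 + a) m)
    ≡⟨ trans (cong (concatMap (arcsEndingAt (suc a))) (range-shift 1 a m)) (LP.concatMap-map (arcsEndingAt (suc a)) (_+ a) (range 1 m)) ⟩
  concatMap (arcsEndingAt (suc a) ∘ (_+ a)) (range 1 m)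
    ≡⟨ LP.concatMap-cong shiftEnd (range 1 m) ⟩
  concatMap (map (shiftArc a) ∘ arcsEndingAt 1) (range 1 m)
    ≡⟨ sym (LP.map-concatMap (shiftArc a) (arcsEndingAt 1) (range 1 m)) ⟩
  map (shiftArc a) (arcsOn 1 m) ∎
  where
  open ≡-Reasoning
  shiftEnd : ∀ j → arcsEndingAt (suc a) (j + a) ≡ map (shiftArc a) (arcsEndingAt 1 j)
  shiftEnd j = begin
    map (λ i → (i , j + a)) (range (suc a) (j + a ∸ suc a))
      ≡⟨ cong (λ t → map (λ i → (i , j + a)) (range (suc a) t)) (trans (cong₂ _∸_ (ℕP.+-comm j a) (ℕP.+-comm 1 a)) (ℕP.[m+n]∸[m+o]≡n∸o a j 1)) ⟩
    map (λ i → (i , j + a)) (range (1 + a) (j ∸ 1))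
      ≡⟨ cong (map (λ i → (i , j + a))) (range-shift 1 a (j ∸ 1)) ⟩
    map (λ i → (i , j + a)) (map (_+ a) (range 1 (j ∸ 1)))
      ≡⟨ trans (sym (LP.map-∘ (range 1 (j ∸ 1)))) (LP.map-∘ (range 1 (j ∸ 1))) ⟩
    map (shiftArc a) (arcsEndingAt 1 j) ∎

-- Zigzag stacks with vertex capacities

vertexOKᵇ : (ℕ → ℕ) → ℕ → ℕ → ℕ → Bool
vertexOKᵇ cap v l r = ((l + r) ≤ᵇ cap v) ∧ not ((0 <ᵇ l) ∧ (0 <ᵇ r))

cappedZigzagᵇ : List ℕ → (ℕ → ℕ) → List Arc → Bool
cappedZigzagᵇ V cap D = isStackᵇ D ∧ all (λ v → vertexOKᵇ cap v (ld D v) (rd D v)) V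

zigzagCount : ℕ → ℕ → (ℕ → ℕ) → ℕ
zigzagCount lo m cap = count (cappedZigzagᵇ (range lo m) cap) (subsets (arcsOn lo m))

noncrossingᵇ : Arc → Arc → Bool
noncrossingᵇ a b = not (crossesᵇ a b)

crosses-false₁ : ∀ (a b : Arc) → (proj₁ a <ᵇ proj₁ b) ≡ false → crossesᵇ a b ≡ false
crosses-false₁ (a₁ , a₂) (b₁ , b₂) e rewrite e = refl

crosses-false₂ : ∀ (a b : Arc) → (proj₁ b <ᵇ proj₂ a) ≡ false → crossesᵇ a b ≡ false
crosses-false₂ (a₁ , a₂) (b₁ , b₂) e rewrite e = BP.∧-zeroʳ (a₁ <ᵇ b₁)

crosses-false₃ : ∀ (a b : Arc) → (proj₂ a <ᵇ proj₂ b) ≡ false → crossesᵇ a b ≡ false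
crosses-false₃ (a₁ , a₂) (b₁ , b₂) e rewrite e with a₁ <ᵇ b₁ | b₁ <ᵇ a₂
... | true | true = refl
... | true | false = refl
... | false | _ = refl

Proper : Arc → Set
Proper a = proj₁ a < proj₂ a

separatedAtᵇ : ℕ → List Arc → Bool
separatedAtᵇ i S = all (λ a → endsBefore i a ∨ startsFrom i a) S

module SplitAt (p : ℕ) (S : List Arc) (proper : All Proper S)
               (separated : separatedAtᵇ p S ≡ true) where

  left right : List Arc
  left = filterᵇ (endsBefore p) S
  right = filterᵇ (startsFrom p) S

  right≡ : right ≡ filterᵇ (not ∘ endsBefore p) S
  right≡ = filterᵇ-cong (All.zipWith startsFrom≡ (proper , all⇒All _ S separated))
    where
    startsFrom≡ : ∀ {a} → Proper a × (endsBefore p a ∨ startsFrom p a) ≡ true → startsFrom p a ≡ not (endsBefore p a)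
    startsFrom≡ {a₁ , a₂} (lt , e) with a₂ <ᵇ p in e′
    ... | true = ≤ᵇ-false (ℕP.<-trans lt (<ᵇ-true⇒< a₂ p e′))
    ... | false = e

  left-ends : All (λ a → proj₂ a < p) left
  left-ends = All.map (λ {a} e → <ᵇ-true⇒< (proj₂ a) p e) (filterᵇ-satisfies (endsBefore p) S)

  right-starts : All (λ a → p ≤ proj₁ a) right
  right-starts = All.map (λ {a} e → ≤ᵇ-true⇒≤ p (proj₁ a) e) (filterᵇ-satisfies (startsFrom p) S)

  left-proper : All Proper left
  left-proper = All-filterᵇ (endsBefore p) proper

  right-proper : All Proper right
  right-proper = All-filterᵇ (startsFrom p) proper

  all-split : (q : Arc → Bool) → all q S ≡ all q left ∧ all q right
  all-split q = trans (all-filter-split q (endsBefore p) S) (cong (λ t → all q left ∧ all q t) (sym right≡))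

  count-split : (q : Arc → Bool) → count q S ≡ count q left + count q right
  count-split q = trans (count-filter-split q (endsBefore p) S) (cong (λ t → count q left + count q t) (sym right≡))

  isStack-split : isStackᵇ S ≡ isStackᵇ left ∧ isStackᵇ right
  isStack-split = begin
    all (λ a → all (noncrossingᵇ a) S) S
      ≡⟨ all-split (λ a → all (noncrossingᵇ a) S) ⟩
    all (λ a → all (noncrossingᵇ a) S) left ∧ all (λ a → all (noncrossingᵇ a) S) right
      ≡⟨ cong₂ _∧_ (all-cong (All.map (λ {a} a<p → trans (all-split (noncrossingᵇ a))
          (trans (cong (all (noncrossingᵇ a) left ∧_) (All⇒all (leftOverRight a<p))) (BP.∧-identityʳ _))) left-ends))
                   (all-cong (All.map (λ {a} p≤a → trans (all-split (noncrossingᵇ a))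
                       (cong (_∧ all (noncrossingᵇ a) right) (All⇒all (rightOverLeft p≤a)))) right-starts)) ⟩
    all (λ a → all (noncrossingᵇ a) left) left ∧ all (λ a → all (noncrossingᵇ a) right) right ∎
    where
    open ≡-Reasoning
    leftOverRight : ∀ {a} → proj₂ a < p → All (λ b → noncrossingᵇ a b ≡ true) right
    leftOverRight {a} a<p = All.map (λ {b} p≤b → cong not (crosses-false₂ a b (<ᵇ-false (ℕP.≤-trans (ℕP.<⇒≤ a<p) p≤b)))) right-starts
    rightOverLeft : ∀ {a} → p ≤ proj₁ a → All (λ b → noncrossingᵇ a b ≡ true) left
    rightOverLeft {a} p≤a = All.zipWith (λ {b} (lt , b<p) → cong not
        (crosses-false₁ a b (<ᵇ-false (ℕP.<⇒≤ (ℕP.<-≤-trans (ℕP.<-trans lt b<p) p≤a))))) (left-proper , left-ends)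

  ld-left : ∀ v → v < p → ld S v ≡ ld left v
  ld-left v v<p = trans (count-split _) (trans (cong (ld left v +_)
      (count-none (All.zipWith (λ (lt , p≤b) → ≡ᵇ-false (λ e → ℕP.<-irrefl (sym e) (ℕP.<-trans v<p (ℕP.≤-<-trans p≤b lt))))
          (right-proper , right-starts)))) (ℕP.+-identityʳ _))

  rd-left : ∀ v → v < p → rd S v ≡ rd left v
  rd-left v v<p = trans (count-split _) (trans (cong (rd left v +_)
      (count-none (All.map (λ p≤b → ≡ᵇ-false (λ e → ℕP.<-irrefl (sym e) (ℕP.<-≤-trans v<p p≤b))) right-starts))) (ℕP.+-identityʳ _))

  ld-right : ∀ v → p ≤ v → ld S v ≡ ld right v
  ld-right v p≤v = trans (count-split _) (cong (_+ ld right v) (count-none (All.map (λ b<p → ≡ᵇ-false (λ e → ℕP.<-irrefl e (ℕP.<-≤-trans b<p p≤v))) left-ends)))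

  rd-right : ∀ v → p ≤ v → rd S v ≡ rd right v
  rd-right v p≤v = trans (count-split _) (cong (_+ rd right v)
      (count-none (All.zipWith (λ (lt , b<p) → ≡ᵇ-false (λ e → ℕP.<-irrefl e (ℕP.<-≤-trans (ℕP.<-trans lt b<p) p≤v))) (left-proper , left-ends))))

  cappedZigzag-split : ∀ lo m₁ m₂ cap → lo + m₁ ≡ p →
    cappedZigzagᵇ (range lo (m₁ + m₂)) cap S ≡ cappedZigzagᵇ (range lo m₁) cap left ∧ cappedZigzagᵇ (range p m₂) cap right
  cappedZigzag-split lo m₁ m₂ cap refl = begin
    isStackᵇ S ∧ all OK (range lo (m₁ + m₂))
      ≡⟨ cong₂ (λ u w → u ∧ all OK w) isStack-split (range-++ lo m₁ m₂) ⟩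
    (isStackᵇ left ∧ isStackᵇ right) ∧ all OK (range lo m₁ ++ range p m₂)
      ≡⟨ cong ((isStackᵇ left ∧ isStackᵇ right) ∧_) (all-++ OK (range lo m₁) _) ⟩
    (isStackᵇ left ∧ isStackᵇ right) ∧ (all OK (range lo m₁) ∧ all OK (range p m₂))
      ≡⟨ cong ((isStackᵇ left ∧ isStackᵇ right) ∧_) (cong₂ _∧_
           (all-cong (All.map (λ {v} (_ , v<p) → cong₂ (vertexOKᵇ cap v) (ld-left v v<p) (rd-left v v<p)) (All-range lo m₁)))
           (all-cong (All.map (λ {v} (p≤v , _) → cong₂ (vertexOKᵇ cap v) (ld-right v p≤v) (rd-right v p≤v)) (All-range p m₂)))) ⟩
    (isStackᵇ left ∧ isStackᵇ right) ∧ (all (OKin left) (range lo m₁) ∧ all (OKin right) (range p m₂))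
      ≡⟨ ∧-interchange (isStackᵇ left) (isStackᵇ right) _ _ ⟩
    (isStackᵇ left ∧ all (OKin left) (range lo m₁)) ∧ (isStackᵇ right ∧ all (OKin right) (range p m₂)) ∎
    where
    open ≡-Reasoning
    OKin : List Arc → ℕ → Bool
    OKin D v = vertexOKᵇ cap v (ld D v) (rd D v)
    OK : ℕ → Bool
    OK = OKin S

-- The hypothesis on q makes all q a condition on the arcs right of the cut only.
zigzagCount-split-with : ∀ lo m₁ m₂ cap (q : Arc → Bool) → (∀ a → proj₂ a < lo + m₁ → q a ≡ true) →
  count (λ S → separatedAtᵇ (lo + m₁) S ∧ (all q S ∧ cappedZigzagᵇ (range lo (m₁ + m₂)) cap S)) (subsets (arcsOn lo (m₁ + m₂)))
  ≡ zigzagCount lo m₁ cap * count (λ S → all q S ∧ cappedZigzagᵇ (range (lo + m₁) m₂) cap S) (subsets (arcsOn (lo + m₁) m₂))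
zigzagCount-split-with lo m₁ m₂ cap q q-left = begin
  count P (subsets L)
    ≡⟨ count-subsets-cong L (All-arcsOn lo (m₁ + m₂)) splits ⟩
  count (splitsAs (endsBefore p) (startsFrom p) g h) (subsets L)
    ≡⟨ count-subsets-splitsAs (endsBefore p) (startsFrom p) g h L (All.map (λ {x} (_ , lt , _) → endsBefore∧startsFrom p x lt) (All-arcsOn lo (m₁ + m₂))) ⟩
  count g (subsets (filterᵇ (endsBefore p) L)) * count h (subsets (filterᵇ (startsFrom p) L))
    ≡⟨ cong₂ (λ u v → count g (subsets u) * count h (subsets v)) (filter-endsBefore-arcsOn lo m₁ m₂) (filter-startsFrom-arcsOn lo m₁ m₂) ⟩
  zigzagCount lo m₁ cap * count h (subsets (arcsOn p m₂)) ∎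
  where
  open ≡-Reasoning
  p : ℕ
  p = lo + m₁
  L : List Arc
  L = arcsOn lo (m₁ + m₂)
  P : List Arc → Bool
  P S = separatedAtᵇ p S ∧ (all q S ∧ cappedZigzagᵇ (range lo (m₁ + m₂)) cap S)
  g h : List Arc → Bool
  g = cappedZigzagᵇ (range lo m₁) cap
  h S = all q S ∧ cappedZigzagᵇ (range p m₂) cap S
  splits : ∀ S → All (ArcOn lo (m₁ + m₂)) S → P S ≡ splitsAs (endsBefore p) (startsFrom p) g h S
  splits S on with separatedAtᵇ p S in e
  ... | false = refl
  ... | true = begin
    all q S ∧ cappedZigzagᵇ (range lo (m₁ + m₂)) cap S
      ≡⟨ cong₂ _∧_ (trans (all-split q) (cong (_∧ all q right) (All⇒all (All.map (q-left _) left-ends))))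
                   (cappedZigzag-split lo m₁ m₂ cap refl) ⟩
    all q right ∧ (g left ∧ cappedZigzagᵇ (range p m₂) cap right)
      ≡⟨ ∧-left-comm (all q right) (g left) _ ⟩
    g left ∧ h right ∎
    where open SplitAt p S (All.map (λ (_ , lt , _) → lt) on) e

zigzagCount-split : ∀ lo m₁ m₂ cap →
  count (λ S → separatedAtᵇ (lo + m₁) S ∧ cappedZigzagᵇ (range lo (m₁ + m₂)) cap S) (subsets (arcsOn lo (m₁ + m₂)))
  ≡ zigzagCount lo m₁ cap * zigzagCount (lo + m₁) m₂ cap
zigzagCount-split lo m₁ m₂ cap = begin
  count (λ S → separatedAtᵇ (lo + m₁) S ∧ cappedZigzagᵇ (range lo (m₁ + m₂)) cap S) (subsets (arcsOn lo (m₁ + m₂)))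
    ≡⟨ count-cong (subsets (arcsOn lo (m₁ + m₂))) (λ S → cong (separatedAtᵇ (lo + m₁) S ∧_)
        (sym (cong (_∧ cappedZigzagᵇ (range lo (m₁ + m₂)) cap S) (all-true S)))) ⟩
  count (λ S → separatedAtᵇ (lo + m₁) S ∧ (all (λ _ → true) S ∧ cappedZigzagᵇ (range lo (m₁ + m₂)) cap S)) (subsets (arcsOn lo (m₁ + m₂)))
    ≡⟨ zigzagCount-split-with lo m₁ m₂ cap (λ _ → true) (λ _ _ → refl) ⟩
  zigzagCount lo m₁ cap * count (λ S → all (λ _ → true) S ∧ cappedZigzagᵇ (range (lo + m₁) m₂) cap S) (subsets (arcsOn (lo + m₁) m₂))
    ≡⟨ cong (zigzagCount lo m₁ cap *_) (count-cong (subsets (arcsOn (lo + m₁) m₂)) (λ S → cong (_∧ cappedZigzagᵇ (range (lo + m₁) m₂) cap S) (all-true S))) ⟩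
  zigzagCount lo m₁ cap * zigzagCount (lo + m₁) m₂ cap ∎
  where
  open ≡-Reasoning
  all-true : (S : List Arc) → all (λ _ → true) S ≡ true
  all-true S = All⇒all (All.tabulate {xs = S} (λ _ → refl))

<ᵇ-+-shift : ∀ x y a → (x + a <ᵇ y + a) ≡ (x <ᵇ y)
<ᵇ-+-shift x y a = Bool-≡-from-⇔ (λ e → <ᵇ-true (ℕP.+-cancelʳ-< a x y (<ᵇ-true⇒< (x + a) (y + a) e))) (λ e → <ᵇ-true (ℕP.+-monoˡ-< a (<ᵇ-true⇒< x y e)))

≡ᵇ-+-shift : ∀ x y a → (x + a ≡ᵇ y + a) ≡ (x ≡ᵇ y)
≡ᵇ-+-shift x y a = Bool-≡-from-⇔
  (λ e → T⇒≡true (ℕP.≡⇒≡ᵇ x y (ℕP.+-cancelʳ-≡ a x y (≡ᵇ-true⇒≡ (x + a) (y + a) e))))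
  (λ e → T⇒≡true (ℕP.≡⇒≡ᵇ (x + a) (y + a) (cong (_+ a) (≡ᵇ-true⇒≡ x y e))))

crosses-shift : ∀ a (x y : Arc) → crossesᵇ (shiftArc a x) (shiftArc a y) ≡ crossesᵇ x y
crosses-shift a (x₁ , x₂) (y₁ , y₂) rewrite <ᵇ-+-shift x₁ y₁ a | <ᵇ-+-shift y₁ x₂ a | <ᵇ-+-shift x₂ y₂ a = refl

cappedZigzag-shift : ∀ a V cap S →
  cappedZigzagᵇ (map (_+ a) V) cap (map (shiftArc a) S) ≡ cappedZigzagᵇ V (λ v → cap (v + a)) S
cappedZigzag-shift a V cap S = cong₂ _∧_ stack vertexConditions
  where
  stack : isStackᵇ (map (shiftArc a) S) ≡ isStackᵇ S
  stack = trans (all-map (λ u → all (noncrossingᵇ u) (map (shiftArc a) S)) (shiftArc a) S)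
    (all-cong′ S (λ x → trans (all-map (noncrossingᵇ (shiftArc a x)) (shiftArc a) S) (all-cong′ S (λ y → cong not (crosses-shift a x y)))))
  ld-shift : ∀ v → ld (map (shiftArc a) S) (v + a) ≡ ld S v
  ld-shift v = trans (count-map (λ u → proj₂ u ≡ᵇ v + a) (shiftArc a) S) (count-cong S (λ x → ≡ᵇ-+-shift (proj₂ x) v a))
  rd-shift : ∀ v → rd (map (shiftArc a) S) (v + a) ≡ rd S v
  rd-shift v = trans (count-map (λ u → proj₁ u ≡ᵇ v + a) (shiftArc a) S) (count-cong S (λ x → ≡ᵇ-+-shift (proj₁ x) v a))
  vertexConditions : all (λ v → vertexOKᵇ cap v (ld (map (shiftArc a) S) v) (rd (map (shiftArc a) S) v)) (map (_+ a) V)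
           ≡ all (λ v → vertexOKᵇ (λ w → cap (w + a)) v (ld S v) (rd S v)) V
  vertexConditions = trans (all-map _ (_+ a) V) (all-cong′ V (λ v → cong₂ (vertexOKᵇ cap (v + a)) (ld-shift v) (rd-shift v)))

zigzagCount-shift : ∀ a m cap → zigzagCount (suc a) m cap ≡ zigzagCount 1 m (λ v → cap (v + a))
zigzagCount-shift a m cap = begin
  count (cappedZigzagᵇ (range (1 + a) m) cap) (subsets (arcsOn (suc a) m))
    ≡⟨ cong₂ (λ u w → count (cappedZigzagᵇ u cap) (subsets w)) (range-shift 1 a m) (arcsOn-shift a m) ⟩
  count (cappedZigzagᵇ (map (_+ a) (range 1 m)) cap) (subsets (map (shiftArc a) (arcsOn 1 m)))
    ≡⟨ cong (count (cappedZigzagᵇ (map (_+ a) (range 1 m)) cap)) (subsets-map (shiftArc a) (arcsOn 1 m)) ⟩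
  count (cappedZigzagᵇ (map (_+ a) (range 1 m)) cap) (map (map (shiftArc a)) (subsets (arcsOn 1 m)))
    ≡⟨ count-map (cappedZigzagᵇ (map (_+ a) (range 1 m)) cap) (map (shiftArc a)) (subsets (arcsOn 1 m)) ⟩
  count (cappedZigzagᵇ (map (_+ a) (range 1 m)) cap ∘ map (shiftArc a)) (subsets (arcsOn 1 m))
    ≡⟨ count-cong (subsets (arcsOn 1 m)) (cappedZigzag-shift a (range 1 m) cap) ⟩
  zigzagCount 1 m (λ v → cap (v + a)) ∎
  where open ≡-Reasoning

zigzagCount-cong : ∀ m cap cap′ → (∀ v → 1 ≤ v → v ≤ m → cap v ≡ cap′ v) → zigzagCount 1 m cap ≡ zigzagCount 1 m cap′
zigzagCount-cong m cap cap′ e = count-cong (subsets (arcsOn 1 m)) (λ S → cong (isStackᵇ S ∧_)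
  (all-cong (All.map (λ {v} (1≤v , v<) → cong (λ c → ((ld S v + rd S v) ≤ᵇ c) ∧ not ((0 <ᵇ ld S v) ∧ (0 <ᵇ rd S v))) (e v 1≤v (ℕP.≤-pred v<))) (All-range 1 m))))

-- Attaching the last vertex

-- The shape is that of a vertex with ld = l and rd = r receiving c ≥ 1 new right arcs.
vertexOK-newRightArcs : ∀ l r c cp → 1 ≤ c →
  (((l + 0) + (r + c)) ≤ᵇ cp) ∧ not ((0 <ᵇ (l + 0)) ∧ (0 <ᵇ (r + c)))
  ≡ (((l + r) ≤ᵇ (cp ∸ c)) ∧ not ((0 <ᵇ l) ∧ (0 <ᵇ r))) ∧ ((c ≤ᵇ cp) ∧ (l ≡ᵇ 0))
vertexOK-newRightArcs (suc l) r c cp 1≤c rewrite <ᵇ-true {0} {r + c} (ℕP.≤-trans 1≤c (ℕP.m≤n+m c r)) =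
  trans (BP.∧-zeroʳ _) (sym (trans (cong ((((suc l + r) ≤ᵇ (cp ∸ c)) ∧ not (true ∧ (0 <ᵇ r))) ∧_) (BP.∧-zeroʳ (c ≤ᵇ cp))) (BP.∧-zeroʳ _)))
vertexOK-newRightArcs zero r c cp 1≤c = trans (BP.∧-identityʳ _) (trans (Bool-≡-from-⇔ split join)
  (sym (cong₂ _∧_ (BP.∧-identityʳ (r ≤ᵇ cp ∸ c)) (BP.∧-identityʳ (c ≤ᵇ cp)))))
  where
  split : (r + c ≤ᵇ cp) ≡ true → ((r ≤ᵇ cp ∸ c) ∧ (c ≤ᵇ cp)) ≡ true
  split e = cong₂ _∧_ (≤ᵇ-true (ℕP.m+n≤o⇒m≤o∸n r (≤ᵇ-true⇒≤ _ _ e))) (≤ᵇ-true (ℕP.≤-trans (ℕP.m≤n+m c r) (≤ᵇ-true⇒≤ _ _ e)))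
  join : ((r ≤ᵇ cp ∸ c) ∧ (c ≤ᵇ cp)) ≡ true → (r + c ≤ᵇ cp) ≡ true
  join e = ≤ᵇ-true (ℕP.m≤o∸n⇒m+n≤o r (≤ᵇ-true⇒≤ _ _ (proj₂ (∧≡true⇒× e))) (≤ᵇ-true⇒≤ _ _ (proj₁ (∧≡true⇒× e))))

separated≡uncovered∧notEnding : ∀ (a : Arc) i → Proper a →
  (endsBefore i a ∨ startsFrom i a) ≡ not ((proj₁ a <ᵇ i) ∧ (i <ᵇ proj₂ a)) ∧ not (proj₂ a ≡ᵇ i)
separated≡uncovered∧notEnding (a₁ , a₂) i lt with ℕP.<-cmp i a₂
... | tri< i<a₂ _ _ rewrite <ᵇ-false {a₂} {i} (ℕP.<⇒≤ i<a₂) | <ᵇ-true i<a₂ | ≡ᵇ-false {a₂} {i} (λ e → ℕP.<-irrefl (sym e) i<a₂)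
  = trans (≤ᵇ≡not<ᵇ i a₁) (sym (trans (BP.∧-identityʳ _) (cong not (BP.∧-identityʳ _))))
... | tri≈ _ refl _ rewrite <ᵇ-false {a₂} {a₂} ℕP.≤-refl | ≤ᵇ-false {a₂} {a₁} lt | ≡ᵇ-refl a₂ = sym (BP.∧-zeroʳ _)
... | tri> _ _ i>a₂ rewrite <ᵇ-true i>a₂ | <ᵇ-false {i} {a₂} (ℕP.<⇒≤ i>a₂) | ≡ᵇ-false {a₂} {i} (λ e → ℕP.<-irrefl e i>a₂)
  = sym (trans (BP.∧-identityʳ _) (cong not (BP.∧-zeroʳ _)))

module AttachLastVertex (n : ℕ) (cap : ℕ → ℕ) (S : List Arc) (I : List ℕ)
  (S-on : All (λ a → Proper a × proj₂ a ≤ n) S)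
  (I-on : All (λ i → 1 ≤ i × i ≤ n) I) where

  N : ℕ
  N = suc n

  newArcs : List Arc
  newArcs = map (λ i → (i , N)) I

  multiplicity : ℕ → ℕ
  multiplicity v = count (λ i → i ≡ᵇ v) I

  residualCap : ℕ → ℕ
  residualCap v = cap v ∸ multiplicity v

  uncovered : ℕ → Bool
  uncovered i = all (λ a → not ((proj₁ a <ᵇ i) ∧ (i <ᵇ proj₂ a))) S

  ld-extended : ∀ v → ld (S ++ newArcs) v ≡ ld S v + count (λ _ → N ≡ᵇ v) I
  ld-extended v = trans (count-++ _ S newArcs) (cong (ld S v +_) (count-map _ _ I))

  rd-extended : ∀ v → rd (S ++ newArcs) v ≡ rd S v + multiplicity v
  rd-extended v = trans (count-++ _ S newArcs) (cong (rd S v +_) (count-map _ _ I))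

  noNewLeftArcs : ∀ v → v ≤ n → count (λ _ → N ≡ᵇ v) I ≡ 0
  noNewLeftArcs v v≤n = count-none (All.map (λ _ → ≡ᵇ-false (λ e → ℕP.<-irrefl (sym e) (s≤s v≤n))) I-on)

  ld-S-N : ld S N ≡ 0
  ld-S-N = count-none (All.map (λ (_ , a₂≤n) → ≡ᵇ-false (λ e → ℕP.<-irrefl e (s≤s a₂≤n))) S-on)

  rd-S-N : rd S N ≡ 0
  rd-S-N = count-none (All.map (λ (lt , a₂≤n) → ≡ᵇ-false (λ e → ℕP.<-irrefl e (ℕP.<-trans lt (s≤s a₂≤n)))) S-on)

  multiplicity-N : multiplicity N ≡ 0
  multiplicity-N = count-none (All.map (λ (_ , i≤n) → ≡ᵇ-false (λ e → ℕP.<-irrefl e (s≤s i≤n))) I-on)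

  isStack-extended : isStackᵇ (S ++ newArcs) ≡ isStackᵇ S ∧ all uncovered I
  isStack-extended = begin
    all (λ a → all (noncrossingᵇ a) (S ++ newArcs)) (S ++ newArcs)
      ≡⟨ all-++ _ S newArcs ⟩
    all (λ a → all (noncrossingᵇ a) (S ++ newArcs)) S ∧ all (λ a → all (noncrossingᵇ a) (S ++ newArcs)) newArcs
      ≡⟨ cong₂ _∧_ (all-cong′ S (λ a → all-++ (noncrossingᵇ a) S newArcs)) (All⇒all {xs = newArcs} (All.map newArcNeverCrosses newArcs-end)) ⟩
    all (λ a → all (noncrossingᵇ a) S ∧ all (noncrossingᵇ a) newArcs) S ∧ true
      ≡⟨ trans (BP.∧-identityʳ _) (all-∧ (λ a → all (noncrossingᵇ a) S) (λ a → all (noncrossingᵇ a) newArcs) S) ⟩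
    isStackᵇ S ∧ all (λ a → all (noncrossingᵇ a) newArcs) S
      ≡⟨ cong (isStackᵇ S ∧_) (all-cong (All.map (λ (_ , a₂≤n) → trans (all-map _ (λ i → (i , N)) I) (all-cong′ I (λ i → crossNew a₂≤n))) S-on)) ⟩
    isStackᵇ S ∧ all (λ a → all (λ i → not ((proj₁ a <ᵇ i) ∧ (i <ᵇ proj₂ a))) I) S
      ≡⟨ cong (isStackᵇ S ∧_) (all-swap (λ a i → not ((proj₁ a <ᵇ i) ∧ (i <ᵇ proj₂ a))) S I) ⟩
    isStackᵇ S ∧ all uncovered I ∎
    where
    open ≡-Reasoning
    newArcs-end : All (λ t → proj₂ t ≡ N) newArcs
    newArcs-end = AllP.map⁺ (All.map (λ _ → refl) I-on)
    ends≤N : All (λ b → proj₂ b ≤ N) (S ++ newArcs)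
    ends≤N = AllP.++⁺ (All.map (λ (_ , a₂≤n) → ℕP.m≤n⇒m≤1+n a₂≤n) S-on) (All.map ℕP.≤-reflexive newArcs-end)
    newArcNeverCrosses : ∀ {t} → proj₂ t ≡ N → all (noncrossingᵇ t) (S ++ newArcs) ≡ true
    newArcNeverCrosses {t} e = All⇒all (All.map (λ {b} b≤N → cong not (crosses-false₃ t b (<ᵇ-false (subst (proj₂ b ≤_) (sym e) b≤N)))) ends≤N)
    crossNew : ∀ {a i} → proj₂ a ≤ n → noncrossingᵇ a (i , N) ≡ not ((proj₁ a <ᵇ i) ∧ (i <ᵇ proj₂ a))
    crossNew {a} {i} a₂≤n = cong (λ t → not ((proj₁ a <ᵇ i) ∧ t)) (trans (cong ((i <ᵇ proj₂ a) ∧_) (<ᵇ-true (s≤s a₂≤n))) (BP.∧-identityʳ _))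

  separated≡ : ∀ i → separatedAtᵇ i S ≡ uncovered i ∧ (ld S i ≡ᵇ 0)
  separated≡ i = trans (all-cong (All.map (λ (lt , _) → separated≡uncovered∧notEnding _ i lt) S-on))
    (trans (all-∧ _ _ S) (cong (uncovered i ∧_) (sym (count≡ᵇ0 (λ a → proj₂ a ≡ᵇ i) S))))

  extendedOK residualOK endpointOK : ℕ → Bool
  extendedOK v = vertexOKᵇ cap v (ld S v + 0) (rd S v + multiplicity v)
  residualOK v = vertexOKᵇ residualCap v (ld S v) (rd S v)
  endpointOK i = (multiplicity i ≤ᵇ cap i) ∧ (ld S i ≡ᵇ 0)

  extendedOK-untouched : ∀ v → multiplicity v ≡ 0 → extendedOK v ≡ residualOK v
  extendedOK-untouched v e rewrite e | ℕP.+-identityʳ (ld S v) | ℕP.+-identityʳ (rd S v) = refl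

  extendedOK-touched : ∀ v → 1 ≤ multiplicity v → extendedOK v ≡ residualOK v ∧ endpointOK v
  extendedOK-touched v = vertexOK-newRightArcs (ld S v) (rd S v) (multiplicity v) (cap v)

  extendedOK⇒residualOK : ∀ v → extendedOK v ≡ true → residualOK v ≡ true
  extendedOK⇒residualOK v ok with multiplicity v ℕ.≟ 0
  ... | yes m≡0 = trans (sym (extendedOK-untouched v m≡0)) ok
  ... | no m≢0 = proj₁ (∧≡true⇒× (trans (sym (extendedOK-touched v (ℕP.n≢0⇒n>0 m≢0))) ok))

  residualOK⇒extendedOK : All (λ i → endpointOK i ≡ true) I → ∀ v → residualOK v ≡ true → extendedOK v ≡ true
  residualOK⇒extendedOK endpoints v ok with multiplicity v ℕ.≟ 0
  ... | yes m≡0 = trans (extendedOK-untouched v m≡0) ok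
  ... | no m≢0 with count-pos⁻ (λ i → i ≡ᵇ v) I (ℕP.n≢0⇒n>0 m≢0)
  ...   | i , i∈I , i≡ᵇv with ≡ᵇ-true⇒≡ i v i≡ᵇv
  ...     | refl = trans (extendedOK-touched v (ℕP.n≢0⇒n>0 m≢0)) (cong₂ _∧_ ok (All.lookup endpoints i∈I))

  all-extendedOK : all extendedOK (range 1 n) ≡ all residualOK (range 1 n) ∧ all endpointOK I
  all-extendedOK = Bool-≡-from-⇔ forward backward
    where
    forward : all extendedOK (range 1 n) ≡ true → (all residualOK (range 1 n) ∧ all endpointOK I) ≡ true
    forward e = cong₂ _∧_ (All⇒all (All.map (λ {v} → extendedOK⇒residualOK v) oks)) (All⇒all {xs = I} (All.tabulate endpoint))
      where
      oks : All (λ v → extendedOK v ≡ true) (range 1 n)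
      oks = all⇒All extendedOK (range 1 n) e
      endpoint : ∀ {i} → i ∈ I → endpointOK i ≡ true
      endpoint {i} i∈I = proj₂ (∧≡true⇒× {a = residualOK i} (trans (sym (extendedOK-touched i (count-pos (λ j → j ≡ᵇ i) i∈I (≡ᵇ-refl i))))
        (All.lookup oks (∈-range 1 n i (proj₁ (All.lookup I-on i∈I)) (s≤s (proj₂ (All.lookup I-on i∈I)))))))
    backward : (all residualOK (range 1 n) ∧ all endpointOK I) ≡ true → all extendedOK (range 1 n) ≡ true
    backward e = All⇒all (All.map (λ {v} → residualOK⇒extendedOK (all⇒All endpointOK I (proj₂ (∧≡true⇒× e))) v)
                                  (all⇒All residualOK (range 1 n) (proj₁ (∧≡true⇒× e))))

  lastVertexOK : vertexOKᵇ cap N (ld (S ++ newArcs) N) (rd (S ++ newArcs) N) ≡ (length I ≤ᵇ cap N)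
  lastVertexOK rewrite ld-extended N | rd-extended N | ld-S-N | rd-S-N | multiplicity-N | ≡ᵇ-refl N | count-true I | ℕP.+-identityʳ (length I) =
    onlyLeft (length I ≤ᵇ cap N) (0 <ᵇ length I)
    where
    onlyLeft : ∀ a b → a ∧ not (b ∧ false) ≡ a
    onlyLeft a b rewrite BP.∧-zeroʳ b = BP.∧-identityʳ a

  cappedZigzag-extended : cappedZigzagᵇ (range 1 N) cap (S ++ newArcs)
    ≡ (length I ≤ᵇ cap N) ∧ all (λ i → (multiplicity i ≤ᵇ cap i) ∧ separatedAtᵇ i S) I ∧ cappedZigzagᵇ (range 1 n) residualCap S
  cappedZigzag-extended = begin
    isStackᵇ (S ++ newArcs) ∧ all OK (range 1 N)
      ≡⟨ cong₂ (λ u w → u ∧ all OK w) isStack-extended (range-snoc 1 n) ⟩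
    (isStackᵇ S ∧ all uncovered I) ∧ all OK (range 1 n ++ N ∷ [])
      ≡⟨ cong ((isStackᵇ S ∧ all uncovered I) ∧_) (all-++ OK (range 1 n) (N ∷ [])) ⟩
    (isStackᵇ S ∧ all uncovered I) ∧ (all OK (range 1 n) ∧ (OK N ∧ true))
      ≡⟨ cong ((isStackᵇ S ∧ all uncovered I) ∧_) (cong₂ _∧_
           (trans (all-cong (All.map (λ {v} (_ , v<N) → cong₂ (vertexOKᵇ cap v)
               (trans (ld-extended v) (cong (ld S v +_) (noNewLeftArcs v (ℕP.≤-pred v<N)))) (rd-extended v)) (All-range 1 n))) all-extendedOK)
           (cong (_∧ true) lastVertexOK)) ⟩
    (isStackᵇ S ∧ all uncovered I) ∧ ((all residualOK (range 1 n) ∧ all endpointOK I) ∧ ((length I ≤ᵇ cap N) ∧ true))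
      ≡⟨ rearrange (isStackᵇ S) (all uncovered I) (all residualOK (range 1 n)) (all endpointOK I) (length I ≤ᵇ cap N) ⟩
    (length I ≤ᵇ cap N) ∧ (all uncovered I ∧ all endpointOK I) ∧ (isStackᵇ S ∧ all residualOK (range 1 n))
      ≡⟨ cong (λ t → (length I ≤ᵇ cap N) ∧ t ∧ (isStackᵇ S ∧ all residualOK (range 1 n)))
              (sym (trans (all-cong′ I (λ i → trans (cong ((multiplicity i ≤ᵇ cap i) ∧_) (separated≡ i)) (∧-left-comm (multiplicity i ≤ᵇ cap i) (uncovered i) _)))
                          (all-∧ uncovered endpointOK I))) ⟩
    (length I ≤ᵇ cap N) ∧ all (λ i → (multiplicity i ≤ᵇ cap i) ∧ separatedAtᵇ i S) I ∧ (isStackᵇ S ∧ all residualOK (range 1 n)) ∎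
    where
    open ≡-Reasoning
    OK : ℕ → Bool
    OK v = vertexOKᵇ cap v (ld (S ++ newArcs) v) (rd (S ++ newArcs) v)
    rearrange : ∀ s x r e l → (s ∧ x) ∧ ((r ∧ e) ∧ (l ∧ true)) ≡ l ∧ (x ∧ e) ∧ (s ∧ r)
    rearrange s x r e l rewrite BP.∧-identityʳ l with l
    ... | false = trans (cong (λ t → (s ∧ x) ∧ t) (BP.∧-zeroʳ (r ∧ e))) (BP.∧-zeroʳ (s ∧ x))
    ... | true = trans (cong ((s ∧ x) ∧_) (BP.∧-identityʳ (r ∧ e))) (trans (∧-interchange s x r e) (BP.∧-comm (s ∧ r) (x ∧ e)))

-- Recursion on the last vertex

cap₁ : ℕ → ℕ → ℕ
cap₁ c v = if v ≡ᵇ 1 then c else 2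

zc : ℕ → ℕ → ℕ
zc c m = zigzagCount 1 m (cap₁ c)

cap₁-beyond1 : ∀ c v → 2 ≤ v → cap₁ c v ≡ 2
cap₁-beyond1 c (suc (suc v)) _ = refl
cap₁-beyond1 c (suc zero) (s≤s ())

cap₁-≤2 : ∀ c v → c ≤ 2 → cap₁ c v ≤ 2
cap₁-≤2 c v c≤2 with v ≡ᵇ 1
... | true = c≤2
... | false = ℕP.≤-refl

zigzagCount≡zc : ∀ a m cap c → cap (suc a) ≡ c → (∀ v → suc a < v → v ≤ a + m → cap v ≡ 2) → zigzagCount (suc a) m cap ≡ zc c m
zigzagCount≡zc a m cap c first rest = trans (zigzagCount-shift a m cap) (zigzagCount-cong m _ (cap₁ c) shifted)
  where
  shifted : ∀ v → 1 ≤ v → v ≤ m → cap (v + a) ≡ cap₁ c v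
  shifted (suc zero) _ _ = first
  shifted (suc (suc w)) _ v≤m = rest (suc (suc w) + a) (s≤s (s≤s (ℕP.m≤n+m a w))) (subst (_≤ a + m) (ℕP.+-comm a (suc (suc w))) (ℕP.+-monoʳ-≤ a v≤m))

ArcOn⇒endsBy : ∀ n S → All (ArcOn 1 n) S → All (λ a → Proper a × proj₂ a ≤ n) S
ArcOn⇒endsBy n S = All.map (λ (_ , lt , a₂<) → lt , ℕP.≤-pred a₂<)

module LastVertex (c : ℕ) (c≤2 : c ≤ 2) (n : ℕ) where

  N : ℕ
  N = suc n

  cap : ℕ → ℕ
  cap = cap₁ c

  arcsToLast : List ℕ → List Arc
  arcsToLast I = map (λ i → (i , N)) I

  withArcsToLast : List ℕ → ℕ
  withArcsToLast I = count (λ S → cappedZigzagᵇ (range 1 N) cap (S ++ arcsToLast I)) (subsets (allArcs n))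

  zc-suc≡sum : zc c N ≡ sumBy withArcsToLast (subsets (range 1 n))
  zc-suc≡sum = begin
    count (cappedZigzagᵇ (range 1 N) cap) (subsets (allArcs N))
      ≡⟨ cong (λ t → count (cappedZigzagᵇ (range 1 N) cap) (subsets t)) (allArcs-suc n) ⟩
    count (cappedZigzagᵇ (range 1 N) cap) (subsets (allArcs n ++ map (λ i → (i , N)) (range 1 n)))
      ≡⟨ count-subsets-++ (cappedZigzagᵇ (range 1 N) cap) (allArcs n) _ ⟩
    sumBy (λ T → count (λ S → cappedZigzagᵇ (range 1 N) cap (S ++ T)) (subsets (allArcs n))) (subsets (map (λ i → (i , N)) (range 1 n)))
      ≡⟨ cong (sumBy _) (subsets-map (λ i → (i , N)) (range 1 n)) ⟩
    sumBy (λ T → count (λ S → cappedZigzagᵇ (range 1 N) cap (S ++ T)) (subsets (allArcs n))) (map arcsToLast (subsets (range 1 n)))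
      ≡⟨ sumBy-map _ _ (subsets (range 1 n)) ⟩
    sumBy withArcsToLast (subsets (range 1 n)) ∎
    where open ≡-Reasoning

  withArcsToLast-≥3 : ∀ a b d I → withArcsToLast (a ∷ b ∷ d ∷ I) ≡ 0
  withArcsToLast-≥3 a b d I = count-none {xs = subsets (allArcs n)} (All.tabulate (λ {S} _ →
    trans (cong (isStackᵇ (S ++ A) ∧_) (all-false (λ v → vertexOKᵇ cap v (ld (S ++ A) v) (rd (S ++ A) v))
                                                    (∈-range 1 N N (s≤s z≤n) ℕP.≤-refl)
                                                    (cong (_∧ not ((0 <ᵇ ld (S ++ A) N) ∧ (0 <ᵇ rd (S ++ A) N))) (≤ᵇ-false (overfull S)))))
          (BP.∧-zeroʳ (isStackᵇ (S ++ A)))))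
    where
    A : List Arc
    A = arcsToLast (a ∷ b ∷ d ∷ I)
    overfull : ∀ S → cap N < ld (S ++ A) N + rd (S ++ A) N
    overfull S rewrite count-++ (λ x → proj₂ x ≡ᵇ N) S A | count-map (λ x → proj₂ x ≡ᵇ N) (λ i → (i , N)) (a ∷ b ∷ d ∷ I) | ≡ᵇ-refl N =
      ℕP.≤-trans (s≤s (cap₁-≤2 c N c≤2)) (ℕP.≤-trans (s≤s (s≤s (s≤s z≤n))) (ℕP.≤-trans (ℕP.m≤n+m _ (ld S N)) (ℕP.m≤m+n _ _)))

  module Attach (S : List Arc) (S-on : All (ArcOn 1 n) S) (I : List ℕ) (I-on : All (λ i → 1 ≤ i × i ≤ n) I) =
    AttachLastVertex n cap S I (ArcOn⇒endsBy n S S-on) I-on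

  withArcsToLast-[] : withArcsToLast [] ≡ zc c n
  withArcsToLast-[] = count-subsets-cong (allArcs n) (All-arcsOn 1 n) (λ S S-on → Attach.cappedZigzag-extended S S-on [] [])

  multiplicityIn : List ℕ → ℕ → ℕ
  multiplicityIn I v = count (λ j → j ≡ᵇ v) I

  multiplicity-absent : ∀ I v → All (λ j → ¬ j ≡ v) I → multiplicityIn I v ≡ 0
  multiplicity-absent I v ne = count-none (All.map ≡ᵇ-false ne)

  module OneArc (i′ : ℕ) (i≤n : suc i′ ≤ n) where

    i : ℕ
    i = suc i′

    residualCap : ℕ → ℕ
    residualCap v = cap v ∸ multiplicityIn (i ∷ []) v

    b : Bool
    b = 1 ≤ᵇ cap i

    multiplicity-i : multiplicityIn (i ∷ []) i ≡ 1
    multiplicity-i rewrite ≡ᵇ-refl i = refl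

    reduceToSeparated : withArcsToLast (i ∷ []) ≡
      indicator b * count (λ S → separatedAtᵇ i S ∧ cappedZigzagᵇ (range 1 n) residualCap S) (subsets (allArcs n))
    reduceToSeparated = trans (count-subsets-cong (allArcs n) (All-arcsOn 1 n) extended) (count-const-∧ b _ (subsets (allArcs n)))
      where
      extended : ∀ S → All (ArcOn 1 n) S →
        cappedZigzagᵇ (range 1 N) cap (S ++ arcsToLast (i ∷ [])) ≡ b ∧ (separatedAtᵇ i S ∧ cappedZigzagᵇ (range 1 n) residualCap S)
      extended S S-on = trans (Attach.cappedZigzag-extended S S-on (i ∷ []) ((s≤s z≤n , i≤n) ∷ []))
        (trans (cong₂ (λ u w → (1 ≤ᵇ u) ∧ (((w ≤ᵇ cap i) ∧ separatedAtᵇ i S) ∧ true) ∧ cappedZigzagᵇ (range 1 n) residualCap S)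
                      (cap₁-beyond1 c N (s≤s (ℕP.≤-trans (s≤s z≤n) i≤n))) multiplicity-i)
               (trans (cong (_∧ cappedZigzagᵇ (range 1 n) residualCap S) (BP.∧-identityʳ (b ∧ separatedAtᵇ i S))) (BP.∧-assoc b (separatedAtᵇ i S) _)))

    withArcsToLast-one : withArcsToLast (i ∷ []) ≡ indicator b * (zc c i′ * zc (cap i ∸ 1) (n ∸ i′))
    withArcsToLast-one = begin
      withArcsToLast (i ∷ [])
        ≡⟨ reduceToSeparated ⟩
      indicator b * count (λ S → separatedAtᵇ i S ∧ cappedZigzagᵇ (range 1 n) residualCap S) (subsets (allArcs n))
        ≡⟨ cong (λ m → indicator b * count (λ S → separatedAtᵇ i S ∧ cappedZigzagᵇ (range 1 m) residualCap S) (subsets (allArcs m)))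
                (sym (ℕP.m+[n∸m]≡n (ℕP.<⇒≤ i≤n))) ⟩
      indicator b * count (λ S → separatedAtᵇ i S ∧ cappedZigzagᵇ (range 1 (i′ + (n ∸ i′))) residualCap S) (subsets (allArcs (i′ + (n ∸ i′))))
        ≡⟨ cong (indicator b *_) (zigzagCount-split 1 i′ (n ∸ i′) residualCap) ⟩
      indicator b * (zigzagCount 1 i′ residualCap * zigzagCount i (n ∸ i′) residualCap)
        ≡⟨ cong (indicator b *_) (cong₂ _*_ before after) ⟩
      indicator b * (zc c i′ * zc (cap i ∸ 1) (n ∸ i′)) ∎
      where
      open ≡-Reasoning
      before : zigzagCount 1 i′ residualCap ≡ zc c i′
      before = zigzagCount-cong i′ residualCap cap (λ v _ v≤i′ → cong (cap v ∸_) (multiplicity-absent (i ∷ []) v ((λ e → ℕP.<-irrefl (sym e) (s≤s v≤i′)) ∷ [])))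
      after : zigzagCount i (n ∸ i′) residualCap ≡ zc (cap i ∸ 1) (n ∸ i′)
      after = zigzagCount≡zc i′ (n ∸ i′) residualCap (cap i ∸ 1) (cong (cap i ∸_) multiplicity-i)
        (λ v i<v _ → trans (cong (cap v ∸_) (multiplicity-absent (i ∷ []) v ((λ e → ℕP.<-irrefl e i<v) ∷ []))) (cap₁-beyond1 c v (ℕP.≤-trans (s≤s (s≤s z≤n)) i<v)))

  module TwoArcs (i′ k′ : ℕ) (i<k : i′ < k′) (k≤n : suc k′ ≤ n) where

    i k : ℕ
    i = suc i′
    k = suc k′

    residualCap : ℕ → ℕ
    residualCap v = cap v ∸ multiplicityIn (i ∷ k ∷ []) v

    b : Bool
    b = 1 ≤ᵇ cap i

    i′≤k′ : i′ ≤ k′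
    i′≤k′ = ℕP.<⇒≤ i<k

    i≤n : i ≤ n
    i≤n = ℕP.≤-trans (s≤s i′≤k′) k≤n

    cap-k : cap k ≡ 2
    cap-k = cap₁-beyond1 c k (s≤s (ℕP.≤-trans (s≤s z≤n) i<k))

    multiplicity-i : multiplicityIn (i ∷ k ∷ []) i ≡ 1
    multiplicity-i rewrite ≡ᵇ-refl i | ≡ᵇ-false {k} {i} (λ e → ℕP.<-irrefl (sym e) (s≤s i<k)) = refl

    multiplicity-k : multiplicityIn (i ∷ k ∷ []) k ≡ 1
    multiplicity-k rewrite ≡ᵇ-refl k | ≡ᵇ-false {i} {k} (λ e → ℕP.<-irrefl e (s≤s i<k)) = refl

    multiplicity-other : ∀ v → ¬ i ≡ v → ¬ k ≡ v → residualCap v ≡ cap v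
    multiplicity-other v i≢v k≢v = cong (cap v ∸_) (multiplicity-absent (i ∷ k ∷ []) v (i≢v ∷ k≢v ∷ []))

    reduceToSeparated : withArcsToLast (i ∷ k ∷ []) ≡ indicator b *
      count (λ S → separatedAtᵇ i S ∧ (separatedAtᵇ k S ∧ cappedZigzagᵇ (range 1 n) residualCap S)) (subsets (allArcs n))
    reduceToSeparated = trans (count-subsets-cong (allArcs n) (All-arcsOn 1 n) extended) (count-const-∧ b _ (subsets (allArcs n)))
      where
      extended : ∀ S → All (ArcOn 1 n) S → cappedZigzagᵇ (range 1 N) cap (S ++ arcsToLast (i ∷ k ∷ []))
        ≡ b ∧ (separatedAtᵇ i S ∧ (separatedAtᵇ k S ∧ cappedZigzagᵇ (range 1 n) residualCap S))
      extended S S-on = trans (Attach.cappedZigzag-extended S S-on (i ∷ k ∷ []) ((s≤s z≤n , i≤n) ∷ (s≤s z≤n , k≤n) ∷ []))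
        (trans (cong₂ (λ u w → (2 ≤ᵇ u) ∧ (((multiplicityIn (i ∷ k ∷ []) i ≤ᵇ cap i) ∧ separatedAtᵇ i S) ∧
            ((w ∧ separatedAtᵇ k S) ∧ true)) ∧ cappedZigzagᵇ (range 1 n) residualCap S)
                      (cap₁-beyond1 c N (s≤s (ℕP.≤-trans (s≤s z≤n) i≤n))) (cong₂ _≤ᵇ_ multiplicity-k cap-k))
        (trans (cong (λ w → (((w ≤ᵇ cap i) ∧ separatedAtᵇ i S) ∧ (separatedAtᵇ k S ∧ true)) ∧ cappedZigzagᵇ (range 1 n) residualCap S) multiplicity-i)
               (reassociate b (separatedAtᵇ i S) (separatedAtᵇ k S) (cappedZigzagᵇ (range 1 n) residualCap S))))
        where
        reassociate : ∀ x y u z → ((x ∧ y) ∧ (u ∧ true)) ∧ z ≡ x ∧ (y ∧ (u ∧ z))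
        reassociate x y u z rewrite BP.∧-identityʳ u = trans (BP.∧-assoc (x ∧ y) u z) (BP.∧-assoc x y (u ∧ z))

    withArcsToLast-two : withArcsToLast (i ∷ k ∷ []) ≡ indicator b * (zc c i′ * (zc (cap i ∸ 1) (k′ ∸ i′) * zc 1 (n ∸ k′)))
    withArcsToLast-two = begin
      withArcsToLast (i ∷ k ∷ [])
        ≡⟨ reduceToSeparated ⟩
      indicator b * Φ n
        ≡⟨ cong (λ m → indicator b * Φ m) (sym (ℕP.m+[n∸m]≡n (ℕP.≤-trans (ℕP.n≤1+n i′) i≤n))) ⟩
      indicator b * Φ (i′ + M)
        ≡⟨ cong (indicator b *_) (zigzagCount-split-with 1 i′ M residualCap _ (λ a a<i → cong (_∨ startsFrom k a) (<ᵇ-true (ℕP.<-trans a<i (s≤s i<k))))) ⟩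
      indicator b * (zigzagCount 1 i′ residualCap * count (λ S → separatedAtᵇ k S ∧ cappedZigzagᵇ (range i M) residualCap S) (subsets (arcsOn i M)))
        ≡⟨ cong (λ t → indicator b * (zigzagCount 1 i′ residualCap * t)) (trans (cong₂ Ψ (sym i+d≡k) M≡d+e) (zigzagCount-split i d e residualCap)) ⟩
      indicator b * (zigzagCount 1 i′ residualCap * (zigzagCount i d residualCap * zigzagCount (i + d) e residualCap))
        ≡⟨ cong (λ t → indicator b * (zigzagCount 1 i′ residualCap * (zigzagCount i d residualCap * zigzagCount t e residualCap))) i+d≡k ⟩
      indicator b * (zigzagCount 1 i′ residualCap * (zigzagCount i d residualCap * zigzagCount k e residualCap))
        ≡⟨ cong (indicator b *_) (cong₂ _*_ before (cong₂ _*_ between after)) ⟩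
      indicator b * (zc c i′ * (zc (cap i ∸ 1) d * zc 1 e)) ∎
      where
      open ≡-Reasoning
      M d e : ℕ
      M = n ∸ i′
      d = k′ ∸ i′
      e = n ∸ k′
      Φ : ℕ → ℕ
      Φ m = count (λ S → separatedAtᵇ i S ∧ (separatedAtᵇ k S ∧ cappedZigzagᵇ (range 1 m) residualCap S)) (subsets (allArcs m))
      Ψ : ℕ → ℕ → ℕ
      Ψ p m = count (λ S → separatedAtᵇ p S ∧ cappedZigzagᵇ (range i m) residualCap S) (subsets (arcsOn i m))
      i+d≡k : i + d ≡ k
      i+d≡k = cong suc (ℕP.m+[n∸m]≡n i′≤k′)
      M≡d+e : M ≡ d + e
      M≡d+e = trans (cong (_∸ i′) (sym (ℕP.m+[n∸m]≡n (ℕP.≤-trans (ℕP.n≤1+n k′) k≤n)))) (ℕP.+-∸-comm (n ∸ k′) i′≤k′)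
      before : zigzagCount 1 i′ residualCap ≡ zc c i′
      before = zigzagCount-cong i′ residualCap cap (λ v _ v≤i′ →
        multiplicity-other v (λ e → ℕP.<-irrefl (sym e) (s≤s v≤i′)) (λ e → ℕP.<-irrefl (sym e) (ℕP.<-trans (s≤s v≤i′) (s≤s i<k))))
      between : zigzagCount i d residualCap ≡ zc (cap i ∸ 1) d
      between = zigzagCount≡zc i′ d residualCap (cap i ∸ 1) (cong (cap i ∸_) multiplicity-i) (λ v i<v v≤ →
        trans (multiplicity-other v (λ e → ℕP.<-irrefl e i<v) (λ e → ℕP.<-irrefl (sym e) (s≤s (subst (v ≤_) (ℕP.m+[n∸m]≡n i′≤k′) v≤))))
              (cap₁-beyond1 c v (ℕP.≤-trans (s≤s (s≤s z≤n)) i<v)))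
      after : zigzagCount k e residualCap ≡ zc 1 e
      after = zigzagCount≡zc k′ e residualCap 1 (trans (cong (cap k ∸_) multiplicity-k) (cong (_∸ 1) cap-k)) (λ v k<v _ →
        trans (multiplicity-other v (λ e → ℕP.<-irrefl e (ℕP.<-trans (s≤s i<k) k<v)) (λ e → ℕP.<-irrefl e k<v))
              (cap₁-beyond1 c v (ℕP.≤-trans (s≤s (s≤s z≤n)) k<v)))

positivePart : (ℕ → ℕ) → ℕ → ℕ
positivePart g zero = 0
positivePart g (suc m) = g (suc m)

convℕ : (ℕ → ℕ) → (ℕ → ℕ) → ℕ → ℕ
convℕ A B n = sumBy (λ j → A j * B (n ∸ j)) (range 0 (suc n))

convℕ-inner : ∀ A B m → A 0 ≡ 0 → B 0 ≡ 0 → convℕ A B (suc m) ≡ sumBy (λ j → A j * B (suc m ∸ j)) (range 1 m)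
convℕ-inner A B m A0 B0 = begin
  h 0 + sumBy h (range 1 (suc m))
    ≡⟨ cong₂ _+_ (cong (_* B (suc m)) A0) (cong (sumBy h) (range-snoc 1 m)) ⟩
  0 + sumBy h (range 1 m ++ suc m ∷ [])
    ≡⟨ sumBy-++ h (range 1 m) (suc m ∷ []) ⟩
  sumBy h (range 1 m) + (A (suc m) * B (suc m ∸ suc m) + 0)
    ≡⟨ cong (λ t → sumBy h (range 1 m) + (A (suc m) * B t + 0)) (ℕP.n∸n≡0 m) ⟩
  sumBy h (range 1 m) + (A (suc m) * B 0 + 0)
    ≡⟨ cong (λ t → sumBy h (range 1 m) + (A (suc m) * t + 0)) B0 ⟩
  sumBy h (range 1 m) + (A (suc m) * 0 + 0)
    ≡⟨ cong (λ t → sumBy h (range 1 m) + (t + 0)) (ℕP.*-zeroʳ (A (suc m))) ⟩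
  sumBy h (range 1 m) + 0
    ≡⟨ ℕP.+-identityʳ _ ⟩
  sumBy h (range 1 m) ∎
  where
  open ≡-Reasoning
  h : ℕ → ℕ
  h j = A j * B (suc m ∸ j)

sumPairs-range : {f : List ℕ → ℕ} → ∀ a m →
  sumPairs f (range a m) ≡ sumBy (λ i → sumBy (λ k → f (i ∷ k ∷ [])) (range (suc i) (a + m ∸ suc i))) (range a m)
sumPairs-range a zero = refl
sumPairs-range {f} a (suc m) = cong₂ _+_ (cong (λ t → sumBy (λ y → f (a ∷ y ∷ [])) (range (suc a) t)) (sym a+m∸a))
  (trans (sumPairs-range (suc a) m) (sumBy-cong′ (range (suc a) m)
      (λ i → cong (λ t → sumBy (λ k → f (i ∷ k ∷ [])) (range (suc i) (t ∸ suc i))) (sym (ℕP.+-suc a m)))))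
  where
  a+m∸a : a + suc m ∸ suc a ≡ m
  a+m∸a = trans (cong (_∸ suc a) (ℕP.+-suc a m)) (ℕP.m+n∸m≡n (suc a) m)

suc-∸ : ∀ m j → j ≤ m → suc m ∸ j ≡ suc (m ∸ j)
suc-∸ m j j≤m = ℕP.+-∸-assoc 1 j≤m

sumBy-range-shift : ∀ (f : ℕ → ℕ) b m → sumBy f (range (suc b) m) ≡ sumBy (f ∘ suc) (range b m)
sumBy-range-shift f b m = trans (cong (sumBy f) (range-suc b m)) (sumBy-map f suc (range b m))

-- An arc (i , N) leaves capacity 1 at a vertex i > 1, giving the factor P, and capacity c - 1
-- at i = 1 (possible only if c ≥ 1), giving the factor Q.
module Convolution (c : ℕ) (c≤2 : c ≤ 2) where

  open LastVertex c c≤2 using (withArcsToLast; zc-suc≡sum; withArcsToLast-≥3; withArcsToLast-[])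
  open LastVertex.OneArc using (withArcsToLast-one)
  open LastVertex.TwoArcs using (withArcsToLast-two)

  Z⁺ P Q : ℕ → ℕ
  Z⁺ = positivePart (zc c)
  P = positivePart (zc 1)
  Q j = indicator (1 ≤ᵇ c) * positivePart (zc (c ∸ 1)) j

  Q0 : Q 0 ≡ 0
  Q0 = ℕP.*-zeroʳ (indicator (1 ≤ᵇ c))

  zc1≡P : ∀ t → 1 ≤ t → zc 1 t ≡ P t
  zc1≡P (suc t) _ = refl

  1≤suc-∸ : ∀ m j → j ≤ m → 1 ≤ suc m ∸ j
  1≤suc-∸ m j j≤m = subst (1 ≤_) (sym (suc-∸ m j j≤m)) (s≤s z≤n)

  singletons≡conv : ∀ n → sumSingletons (withArcsToLast n) (range 1 n) ≡ convℕ Z⁺ P n + Q n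
  singletons≡conv zero = sym (cong (0 +_) Q0)
  singletons≡conv (suc m) = begin
    f (1 ∷ []) + sumBy (λ i → f (i ∷ [])) (range 2 m)
      ≡⟨ cong₂ _+_ (trans (withArcsToLast-one c c≤2 (suc m) 0 (s≤s z≤n)) (cong (indicator (1 ≤ᵇ c) *_) (ℕP.+-identityʳ _)))
                   (sumBy-range-shift (λ i → f (i ∷ [])) 1 m) ⟩
    Q (suc m) + sumBy (λ j → f (suc j ∷ [])) (range 1 m)
      ≡⟨ cong (Q (suc m) +_) (sumBy-cong (All.map (λ {j} (1≤j , j<) → term j 1≤j (ℕP.≤-pred j<)) (All-range 1 m))) ⟩
    Q (suc m) + sumBy (λ j → Z⁺ j * P (suc m ∸ j)) (range 1 m)
      ≡⟨ ℕP.+-comm (Q (suc m)) _ ⟩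
    sumBy (λ j → Z⁺ j * P (suc m ∸ j)) (range 1 m) + Q (suc m)
      ≡⟨ cong (_+ Q (suc m)) (sym (convℕ-inner Z⁺ P m refl refl)) ⟩
    convℕ Z⁺ P (suc m) + Q (suc m) ∎
    where
    open ≡-Reasoning
    f : List ℕ → ℕ
    f = withArcsToLast (suc m)
    term : ∀ j → 1 ≤ j → j ≤ m → f (suc j ∷ []) ≡ Z⁺ j * P (suc m ∸ j)
    term (suc j) _ j≤m = trans (withArcsToLast-one c c≤2 (suc m) (suc j) (s≤s j≤m))
      (trans (ℕP.+-identityʳ _) (cong (zc c (suc j) *_) (zc1≡P _ (1≤suc-∸ m (suc j) j≤m))))

  pairAt1≡ : ∀ m k → 1 ≤ k → k ≤ m → withArcsToLast (suc m) (1 ∷ suc k ∷ []) ≡ Q k * P (suc m ∸ k)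
  pairAt1≡ m (suc k) _ k≤m = trans (withArcsToLast-two c c≤2 (suc m) 0 (suc k) (s≤s z≤n) (s≤s k≤m))
    (trans (cong (λ t → indicator (1 ≤ᵇ c) * ((zc (c ∸ 1) (suc k) * t) + 0)) (zc1≡P _ (1≤suc-∸ m (suc k) k≤m)))
           (reassociate (indicator (1 ≤ᵇ c)) (zc (c ∸ 1) (suc k)) (P (suc m ∸ suc k))))
    where
    reassociate : ∀ a b d → a * (b * d + 0) ≡ a * b * d
    reassociate = ℕSolver.solve-∀

  pairsStartingAt≡ : ∀ m j → 1 ≤ j → j ≤ m →
    sumBy (λ k → withArcsToLast (suc m) (suc j ∷ k ∷ [])) (range (suc (suc j)) (m ∸ j)) ≡ Z⁺ j * convℕ P P (suc m ∸ j)
  pairsStartingAt≡ m (suc j) _ j≤m = begin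
    sumBy (λ k → f (suc (suc j) ∷ k ∷ [])) (range (suc (suc (suc j))) M)
      ≡⟨ trans (sumBy-range-shift (λ k → f (suc (suc j) ∷ k ∷ [])) (suc (suc j)) M)
               (trans (cong (sumBy (λ k → f (suc (suc j) ∷ suc k ∷ []))) (range-shift 1 (suc j) M))
                      (sumBy-map (λ k → f (suc (suc j) ∷ suc k ∷ [])) (_+ suc j) (range 1 M))) ⟩
    sumBy (λ l → f (suc (suc j) ∷ suc (l + suc j) ∷ [])) (range 1 M)
      ≡⟨ sumBy-cong (All.map (λ {l} (1≤l , l<) → term l 1≤l (ℕP.≤-pred l<)) (All-range 1 M)) ⟩
    sumBy (λ l → zc c (suc j) * (P l * P (suc M ∸ l))) (range 1 M)
      ≡⟨ sumBy-*ˡ (zc c (suc j)) _ (range 1 M) ⟩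
    zc c (suc j) * sumBy (λ l → P l * P (suc M ∸ l)) (range 1 M)
      ≡⟨ cong (zc c (suc j) *_) (sym (convℕ-inner P P M refl refl)) ⟩
    zc c (suc j) * convℕ P P (suc M)
      ≡⟨ cong (λ t → zc c (suc j) * convℕ P P t) (sym (suc-∸ m (suc j) j≤m)) ⟩
    Z⁺ (suc j) * convℕ P P (suc m ∸ suc j) ∎
    where
    open ≡-Reasoning
    f : List ℕ → ℕ
    f = withArcsToLast (suc m)
    M : ℕ
    M = m ∸ suc j
    lastGap : ∀ l → suc m ∸ (suc l + suc j) ≡ suc M ∸ suc l
    lastGap l = trans (cong (suc m ∸_) (ℕP.+-comm (suc l) (suc j)))
      (trans (sym (ℕP.∸-+-assoc (suc m) (suc j) (suc l))) (cong (_∸ suc l) (suc-∸ m (suc j) j≤m)))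
    term : ∀ l → 1 ≤ l → l ≤ M → f (suc (suc j) ∷ suc (l + suc j) ∷ []) ≡ zc c (suc j) * (P l * P (suc M ∸ l))
    term (suc l) _ l≤M = trans (withArcsToLast-two c c≤2 (suc m) (suc j) (suc l + suc j) (s≤s (ℕP.m≤n+m (suc j) l))
        (s≤s (subst (_≤ m) (ℕP.+-comm (suc j) (suc l)) (subst (suc j + suc l ≤_) (ℕP.m+[n∸m]≡n j≤m) (ℕP.+-monoʳ-≤ (suc j) l≤M)))))
      (trans (ℕP.+-identityʳ _) (cong₂ (λ u w → zc c (suc j) * (u * w))
        (cong (zc 1) (ℕP.m+n∸n≡m (suc l) (suc j)))
        (trans (cong (zc 1) (lastGap l)) (zc1≡P _ (1≤suc-∸ M (suc l) l≤M)))))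

  pairs≡conv : ∀ n → sumPairs (withArcsToLast n) (range 1 n) ≡ convℕ Z⁺ (convℕ P P) n + convℕ Q P n
  pairs≡conv zero = sym (cong (λ t → t * 0 + 0) Q0)
  pairs≡conv (suc m) = begin
    sumPairs f (range 1 (suc m))
      ≡⟨ sumPairs-range 1 (suc m) ⟩
    sumBy (λ k → f (1 ∷ k ∷ [])) (range 2 m) + sumBy (λ i → sumBy (λ k → f (i ∷ k ∷ [])) (range (suc i) (suc m ∸ i))) (range 2 m)
      ≡⟨ cong₂ _+_ (sumBy-range-shift (λ k → f (1 ∷ k ∷ [])) 1 m)
                   (sumBy-range-shift (λ i → sumBy (λ k → f (i ∷ k ∷ [])) (range (suc i) (suc m ∸ i))) 1 m) ⟩
    sumBy (λ k → f (1 ∷ suc k ∷ [])) (range 1 m) + sumBy (λ j → sumBy (λ k → f (suc j ∷ k ∷ [])) (range (suc (suc j)) (m ∸ j))) (range 1 m)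
      ≡⟨ cong₂ _+_ (sumBy-cong (All.map (λ {k} (1≤k , k<) → pairAt1≡ m k 1≤k (ℕP.≤-pred k<)) (All-range 1 m)))
                   (sumBy-cong (All.map (λ {j} (1≤j , j<) → pairsStartingAt≡ m j 1≤j (ℕP.≤-pred j<)) (All-range 1 m))) ⟩
    sumBy (λ k → Q k * P (suc m ∸ k)) (range 1 m) + sumBy (λ j → Z⁺ j * convℕ P P (suc m ∸ j)) (range 1 m)
      ≡⟨ ℕP.+-comm (sumBy (λ k → Q k * P (suc m ∸ k)) (range 1 m)) _ ⟩
    sumBy (λ j → Z⁺ j * convℕ P P (suc m ∸ j)) (range 1 m) + sumBy (λ k → Q k * P (suc m ∸ k)) (range 1 m)
      ≡⟨ sym (cong₂ _+_ (convℕ-inner Z⁺ (convℕ P P) m refl refl) (convℕ-inner Q P m Q0 refl)) ⟩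
    convℕ Z⁺ (convℕ P P) (suc m) + convℕ Q P (suc m) ∎
    where
    open ≡-Reasoning
    f : List ℕ → ℕ
    f = withArcsToLast (suc m)

  zc-recurrence : ∀ n → zc c (suc n) ≡ zc c n + (convℕ Z⁺ P n + Q n) + (convℕ Z⁺ (convℕ P P) n + convℕ Q P n)
  zc-recurrence n = trans (zc-suc≡sum n) (trans (sumBy-subsets-atMostPairs (withArcsToLast n) (withArcsToLast-≥3 n) (range 1 n))
    (cong₂ _+_ (cong₂ _+_ (withArcsToLast-[] n) (singletons≡conv n)) (pairs≡conv n)))

-- The ring of formal power series

sumUpTo-cong : ∀ {h h′ : ℕ → ℤ} n → (∀ k → k ≤ n → h k ≡ h′ k) → sumUpTo h n ≡ sumUpTo h′ n
sumUpTo-cong zero e = e 0 z≤n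
sumUpTo-cong (suc n) e = cong₂ _+ℤ_ (sumUpTo-cong n (λ k k≤n → e k (ℕP.m≤n⇒m≤1+n k≤n))) (e (suc n) ℕP.≤-refl)

sumUpTo-suc : ∀ (h : ℕ → ℤ) n → sumUpTo h (suc n) ≡ h 0 +ℤ sumUpTo (h ∘ suc) n
sumUpTo-suc h zero = refl
sumUpTo-suc h (suc n) = trans (cong (_+ℤ h (suc (suc n))) (sumUpTo-suc h n)) (ℤP.+-assoc (h 0) _ _)

sumUpTo-zero : ∀ (h : ℕ → ℤ) n → (∀ k → h k ≡ ℤ.+ 0) → sumUpTo h n ≡ ℤ.+ 0
sumUpTo-zero h zero e = e 0
sumUpTo-zero h (suc n) e = cong₂ _+ℤ_ (sumUpTo-zero h n e) (e (suc n))

sumUpTo-+ : ∀ (h g : ℕ → ℤ) n → sumUpTo (λ k → h k +ℤ g k) n ≡ sumUpTo h n +ℤ sumUpTo g n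
sumUpTo-+ h g zero = refl
sumUpTo-+ h g (suc n) = trans (cong (_+ℤ (h (suc n) +ℤ g (suc n))) (sumUpTo-+ h g n)) (interchange (sumUpTo h n) (sumUpTo g n) _ _)
  where
  interchange : ∀ a b c d → (a +ℤ b) +ℤ (c +ℤ d) ≡ (a +ℤ c) +ℤ (b +ℤ d)
  interchange = ℤSolver.solve-∀

sumUpTo-*ˡ : ∀ (c : ℤ) (h : ℕ → ℤ) n → sumUpTo (λ k → c *ℤ h k) n ≡ c *ℤ sumUpTo h n
sumUpTo-*ˡ c h zero = refl
sumUpTo-*ˡ c h (suc n) = trans (cong (_+ℤ (c *ℤ h (suc n))) (sumUpTo-*ˡ c h n)) (sym (ℤP.*-distribˡ-+ c (sumUpTo h n) (h (suc n))))

infix 4 _≈_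
_≈_ : FPS → FPS → Set
f ≈ g = ∀ n → f n ≡ g n

tail : FPS → FPS
tail f = f ∘ suc

scale : ℤ → FPS → FPS
scale c f n = c *ℤ f n

𝟘-coeff : ∀ n → 𝟘 n ≡ ℤ.+ 0
𝟘-coeff zero = refl
𝟘-coeff (suc n) = refl

⊗-suc : ∀ f g n → (f ⊗ g) (suc n) ≡ f 0 *ℤ g (suc n) +ℤ (tail f ⊗ g) n
⊗-suc f g n = sumUpTo-suc (λ k → f k *ℤ g (suc n ∸ k)) n

⊗-sucʳ : ∀ f g n → (f ⊗ g) (suc n) ≡ (f ⊗ tail g) n +ℤ f (suc n) *ℤ g 0
⊗-sucʳ f g n = cong₂ _+ℤ_
  (sumUpTo-cong n (λ k k≤n → cong (λ m → f k *ℤ g m) (ℕP.+-∸-assoc 1 k≤n)))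
  (cong (λ m → f (suc n) *ℤ g m) (ℕP.n∸n≡0 n))

⊗-cong : ∀ {f f′ g g′} → f ≈ f′ → g ≈ g′ → f ⊗ g ≈ f′ ⊗ g′
⊗-cong f≈f′ g≈g′ n = sumUpTo-cong n (λ k _ → cong₂ _*ℤ_ (f≈f′ k) (g≈g′ (n ∸ k)))

⊗-zeroˡ : ∀ {f} g → f ≈ 𝟘 → f ⊗ g ≈ 𝟘
⊗-zeroˡ {f} g f≈𝟘 n = trans (sumUpTo-zero _ n (λ k → trans (cong (_*ℤ g (n ∸ k)) (trans (f≈𝟘 k) (𝟘-coeff k))) (ℤP.*-zeroˡ (g (n ∸ k)))))
  (sym (𝟘-coeff n))

⊗-comm : ∀ f g → f ⊗ g ≈ g ⊗ f
⊗-comm f g zero = ℤP.*-comm (f 0) (g 0)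
⊗-comm f g (suc n) = begin
  (f ⊗ g) (suc n)                    ≡⟨ ⊗-suc f g n ⟩
  f 0 *ℤ g (suc n) +ℤ (tail f ⊗ g) n ≡⟨ cong₂ _+ℤ_ (ℤP.*-comm (f 0) _) (⊗-comm (tail f) g n) ⟩
  g (suc n) *ℤ f 0 +ℤ (g ⊗ tail f) n ≡⟨ ℤP.+-comm (g (suc n) *ℤ f 0) _ ⟩
  (g ⊗ tail f) n +ℤ g (suc n) *ℤ f 0 ≡⟨ sym (⊗-sucʳ g f n) ⟩
  (g ⊗ f) (suc n)                    ∎
  where open ≡-Reasoning

⊗-distribʳ : ∀ f g h → (f ⊕ g) ⊗ h ≈ (f ⊗ h) ⊕ (g ⊗ h)
⊗-distribʳ f g h n = trans (sumUpTo-cong n (λ k _ → ℤP.*-distribʳ-+ (h (n ∸ k)) (f k) (g k))) (sumUpTo-+ _ _ n)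

scale-⊗ : ∀ c f g → scale c f ⊗ g ≈ scale c (f ⊗ g)
scale-⊗ c f g n = trans (sumUpTo-cong n (λ k _ → ℤP.*-assoc c (f k) (g (n ∸ k)))) (sumUpTo-*ˡ c _ n)

⊗-assoc : ∀ f g h → (f ⊗ g) ⊗ h ≈ f ⊗ (g ⊗ h)
⊗-assoc f g h zero = ℤP.*-assoc (f 0) (g 0) (h 0)
⊗-assoc f g h (suc n) = begin
  ((f ⊗ g) ⊗ h) (suc n)
    ≡⟨ ⊗-suc (f ⊗ g) h n ⟩
  f 0 *ℤ g 0 *ℤ h (suc n) +ℤ (tail (f ⊗ g) ⊗ h) n
    ≡⟨ cong (f 0 *ℤ g 0 *ℤ h (suc n) +ℤ_) (⊗-cong {g = h} (⊗-suc f g) (λ _ → refl) n) ⟩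
  f 0 *ℤ g 0 *ℤ h (suc n) +ℤ ((scale (f 0) (tail g) ⊕ (tail f ⊗ g)) ⊗ h) n
    ≡⟨ cong (f 0 *ℤ g 0 *ℤ h (suc n) +ℤ_) (trans (⊗-distribʳ (scale (f 0) (tail g)) (tail f ⊗ g) h n)
                                                 (cong₂ _+ℤ_ (scale-⊗ (f 0) (tail g) h n) (⊗-assoc (tail f) g h n))) ⟩
  f 0 *ℤ g 0 *ℤ h (suc n) +ℤ (f 0 *ℤ (tail g ⊗ h) n +ℤ (tail f ⊗ (g ⊗ h)) n)
    ≡⟨ factor (f 0) (g 0) (h (suc n)) ((tail g ⊗ h) n) ((tail f ⊗ (g ⊗ h)) n) ⟩
  f 0 *ℤ (g 0 *ℤ h (suc n) +ℤ (tail g ⊗ h) n) +ℤ (tail f ⊗ (g ⊗ h)) n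
    ≡⟨ cong (λ t → f 0 *ℤ t +ℤ (tail f ⊗ (g ⊗ h)) n) (sym (⊗-suc g h n)) ⟩
  f 0 *ℤ (g ⊗ h) (suc n) +ℤ (tail f ⊗ (g ⊗ h)) n
    ≡⟨ sym (⊗-suc f (g ⊗ h) n) ⟩
  (f ⊗ (g ⊗ h)) (suc n) ∎
  where
  open ≡-Reasoning
  factor : ∀ a b c d e → a *ℤ b *ℤ c +ℤ (a *ℤ d +ℤ e) ≡ a *ℤ (b *ℤ c +ℤ d) +ℤ e
  factor = ℤSolver.solve-∀

tail-𝟙 : tail 𝟙 ≈ 𝟘
tail-𝟙 zero = refl
tail-𝟙 (suc n) = refl

⊗-identityˡ : ∀ f → 𝟙 ⊗ f ≈ f
⊗-identityˡ f zero = ℤP.*-identityˡ (f 0)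
⊗-identityˡ f (suc n) = trans (⊗-suc 𝟙 f n)
  (trans (cong₂ _+ℤ_ (ℤP.*-identityˡ (f (suc n))) (trans (⊗-zeroˡ f tail-𝟙 n) (𝟘-coeff n))) (ℤP.+-identityʳ _))

open import Algebra.Structures _≈_ using (IsCommutativeRing)

≈-isEquivalence : IsEquivalence _≈_
≈-isEquivalence = record { refl = λ _ → refl ; sym = λ e n → sym (e n) ; trans = λ e₁ e₂ n → trans (e₁ n) (e₂ n) }

FPS-isCommutativeRing : IsCommutativeRing _⊕_ _⊗_ ⊖_ 𝟘 𝟙
FPS-isCommutativeRing = record
  { isRing = record
    { +-isAbelianGroup = record
      { isGroup = record
        { isMonoid = record
          { isSemigroup = record
            { isMagma = record { isEquivalence = ≈-isEquivalence ; ∙-cong = λ e₁ e₂ n → cong₂ _+ℤ_ (e₁ n) (e₂ n) }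
            ; assoc = λ f g h n → ℤP.+-assoc (f n) (g n) (h n) }
          ; identity = (λ f n → trans (cong (_+ℤ f n) (𝟘-coeff n)) (ℤP.+-identityˡ (f n)))
                     , (λ f n → trans (cong (f n +ℤ_) (𝟘-coeff n)) (ℤP.+-identityʳ (f n))) }
        ; inverse = (λ f n → trans (ℤP.+-inverseˡ (f n)) (sym (𝟘-coeff n)))
                  , (λ f n → trans (ℤP.+-inverseʳ (f n)) (sym (𝟘-coeff n)))
        ; ⁻¹-cong = λ e n → cong -ℤ_ (e n) }
      ; comm = λ f g n → ℤP.+-comm (f n) (g n) }
    ; *-cong = ⊗-cong
    ; *-assoc = ⊗-assoc
    ; *-identity = ⊗-identityˡ , (λ f n → trans (⊗-comm f 𝟙 n) (⊗-identityˡ f n))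
    ; distrib = (λ f g h n → trans (⊗-comm f (g ⊕ h) n) (trans (⊗-distribʳ g h f n) (cong₂ _+ℤ_ (⊗-comm g f n) (⊗-comm h f n))))
              , (λ f g h → ⊗-distribʳ g h f) }
  ; *-comm = ⊗-comm }

FPS-commutativeRing : CommutativeRing _ _
FPS-commutativeRing = record { isCommutativeRing = FPS-isCommutativeRing }


FPS-almostCommutativeRing : AlmostCommutativeRing _ _
FPS-almostCommutativeRing = fromCommutativeRing FPS-commutativeRing

const-homomorphism : CommutativeRing.rawRing ℤP.+-*-commutativeRing -Raw-AlmostCommutative⟶ FPS-almostCommutativeRing
const-homomorphism = record
  { ⟦_⟧ = const
  ; +-homo = λ a b → λ { zero → refl ; (suc n) → refl }
  ; *-homo = λ a b → λ { zero → refl ; (suc n) → sym (trans (⊗-suc (const a) (const b) n)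
        (trans (cong₂ _+ℤ_ (ℤP.*-zeroʳ a) (⊗-zeroˡ {tail (const a)} (const b) (λ { zero → refl ; (suc _) → refl }) n)) (trans (ℤP.+-identityˡ _) (𝟘-coeff n)))) }
  ; -‿homo = λ a → λ { zero → refl ; (suc n) → refl }
  ; 0-homo = λ { zero → refl ; (suc n) → refl }
  ; 1-homo = λ { zero → refl ; (suc n) → refl } }


const-≈? : (a b : ℤ) → Maybe (const a ≈ const b)
const-≈? a b with a ℤ.≟ b
... | yes refl = just (λ _ → refl)
... | no _ = nothing

open import Algebra.Solver.Ring (CommutativeRing.rawRing ℤP.+-*-commutativeRing) FPS-almostCommutativeRing const-homomorphism const-≈?
  using (solve; _:=_; Polynomial; con; _:+_; _:*_; _:-_; :-_)

toFPS : (ℕ → ℕ) → FPS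
toFPS A m = ℤ.+ A m

toFPS-sumBy : ∀ (g : ℕ → ℕ) n → ℤ.+ sumBy g (range 0 (suc n)) ≡ sumUpTo (λ j → ℤ.+ g j) n
toFPS-sumBy g zero = cong ℤ.+_ (ℕP.+-identityʳ (g 0))
toFPS-sumBy g (suc n) = begin
  ℤ.+ sumBy g (range 0 (suc (suc n)))
    ≡⟨ cong (λ t → ℤ.+ sumBy g t) (range-snoc 0 (suc n)) ⟩
  ℤ.+ sumBy g (range 0 (suc n) ++ suc n ∷ [])
    ≡⟨ cong ℤ.+_ (trans (sumBy-++ g (range 0 (suc n)) (suc n ∷ [])) (cong (sumBy g (range 0 (suc n)) +_) (ℕP.+-identityʳ _))) ⟩
  ℤ.+ (sumBy g (range 0 (suc n)) + g (suc n))
    ≡⟨ ℤP.pos-+ (sumBy g (range 0 (suc n))) (g (suc n)) ⟩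
  ℤ.+ sumBy g (range 0 (suc n)) +ℤ ℤ.+ g (suc n)
    ≡⟨ cong (_+ℤ ℤ.+ g (suc n)) (toFPS-sumBy g n) ⟩
  sumUpTo (λ j → ℤ.+ g j) (suc n) ∎
  where open ≡-Reasoning

toFPS-convℕ : ∀ A B → toFPS (convℕ A B) ≈ toFPS A ⊗ toFPS B
toFPS-convℕ A B n = trans (toFPS-sumBy (λ j → A j * B (n ∸ j)) n) (sumUpTo-cong n (λ j _ → ℤP.pos-* (A j) (B (n ∸ j))))

toFPS-positivePart : ∀ g → g 0 ≡ 1 → toFPS (positivePart g) ≈ toFPS g ⊖ 𝟙
toFPS-positivePart g g0≡1 zero rewrite g0≡1 = refl
toFPS-positivePart g g0≡1 (suc m) = sym (ℤP.+-identityʳ (ℤ.+ g (suc m)))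

tail-X : tail X ≈ 𝟙
tail-X zero = refl
tail-X (suc n) = refl

X⊗-suc : ∀ f n → (X ⊗ f) (suc n) ≡ f n
X⊗-suc f n = trans (⊗-suc X f n) (trans (ℤP.+-identityˡ _) (trans (⊗-cong {g = f} tail-X (λ _ → refl) n) (⊗-identityˡ f n)))

recurrenceRHS : FPS → FPS → FPS → FPS → FPS
recurrenceRHS x z p q = 𝟙 ⊕ x ⊗ z ⊕ x ⊗ ((z ⊖ 𝟙) ⊗ p ⊕ q) ⊕ x ⊗ ((z ⊖ 𝟙) ⊗ (p ⊗ p) ⊕ q ⊗ p)

module _ (c : ℕ) (c≤2 : c ≤ 2) where
  open Convolution c c≤2

  zc-equation : (q : FPS) → toFPS Q ≈ q → toFPS (zc c) ≈ recurrenceRHS X (toFPS (zc c)) (toFPS (zc 1) ⊖ 𝟙) q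
  zc-equation q Q≈q zero = refl
  zc-equation q Q≈q (suc m) = begin
    ℤ.+ zc c (suc m)
      ≡⟨ cong ℤ.+_ (zc-recurrence m) ⟩
    ℤ.+ (zc c m + (convℕ Z⁺ P m + Q m) + (convℕ Z⁺ (convℕ P P) m + convℕ Q P m))
      ≡⟨ trans (ℤP.pos-+ (zc c m + _) _) (cong₂ _+ℤ_ (trans (ℤP.pos-+ (zc c m) _) (cong (ℤ.+ zc c m +ℤ_) (ℤP.pos-+ (convℕ Z⁺ P m) (Q m))))
          (ℤP.pos-+ (convℕ Z⁺ (convℕ P P) m) _)) ⟩
    ℤ.+ zc c m +ℤ (ℤ.+ convℕ Z⁺ P m +ℤ ℤ.+ Q m) +ℤ (ℤ.+ convℕ Z⁺ (convℕ P P) m +ℤ ℤ.+ convℕ Q P m)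
      ≡⟨ cong₂ _+ℤ_ (cong₂ _+ℤ_ (sym (trans (ℤP.+-identityˡ _) (X⊗-suc (toFPS (zc c)) m)))
                                (sym (trans (X⊗-suc ((toFPS (zc c) ⊖ 𝟙) ⊗ p̂ ⊕ q) m) (cong₂ _+ℤ_ (sym (single m)) (sym (Q≈q m))))))
                    (sym (trans (X⊗-suc ((toFPS (zc c) ⊖ 𝟙) ⊗ (p̂ ⊗ p̂) ⊕ q ⊗ p̂) m) (cong₂ _+ℤ_ (sym (double m)) (sym (mixed m))))) ⟩
    recurrenceRHS X (toFPS (zc c)) p̂ q (suc m) ∎
    where
    open ≡-Reasoning
    p̂ : FPS
    p̂ = toFPS (zc 1) ⊖ 𝟙
    Z⁺≈ : toFPS Z⁺ ≈ toFPS (zc c) ⊖ 𝟙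
    Z⁺≈ = toFPS-positivePart (zc c) refl
    P≈ : toFPS P ≈ p̂
    P≈ = toFPS-positivePart (zc 1) refl
    single : toFPS (convℕ Z⁺ P) ≈ (toFPS (zc c) ⊖ 𝟙) ⊗ p̂
    single k = trans (toFPS-convℕ Z⁺ P k) (⊗-cong Z⁺≈ P≈ k)
    double : toFPS (convℕ Z⁺ (convℕ P P)) ≈ (toFPS (zc c) ⊖ 𝟙) ⊗ (p̂ ⊗ p̂)
    double k = trans (toFPS-convℕ Z⁺ (convℕ P P) k) (⊗-cong Z⁺≈ (λ j → trans (toFPS-convℕ P P j) (⊗-cong P≈ P≈ j)) k)
    mixed : toFPS (convℕ Q P) ≈ q ⊗ p̂
    mixed k = trans (toFPS-convℕ Q P k) (⊗-cong Q≈q P≈ k)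

-- Solving the system of equations

recurrenceRHSᴾ : ∀ {k} → Polynomial k → Polynomial k → Polynomial k → Polynomial k → Polynomial k
recurrenceRHSᴾ {k} x z p q = 1ᴾ :+ x :* z :+ x :* ((z :- 1ᴾ) :* p :+ q) :+ x :* ((z :- 1ᴾ) :* (p :* p) :+ q :* p)
  where
  1ᴾ : Polynomial k
  1ᴾ = con (ℤ.+ 1)

≈⇒⊖≈𝟘 : ∀ {f g} → f ≈ g → f ⊖ g ≈ 𝟘
≈⇒⊖≈𝟘 {f} {g} f≈g n = trans (cong (_+ℤ -ℤ g n) (f≈g n)) (trans (ℤP.+-inverseʳ (g n)) (sym (𝟘-coeff n)))

⊕-≈𝟘 : ∀ {f g} → f ≈ 𝟘 → g ≈ 𝟘 → f ⊕ g ≈ 𝟘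
⊕-≈𝟘 f≈𝟘 g≈𝟘 n = trans (cong₂ _+ℤ_ (trans (f≈𝟘 n) (𝟘-coeff n)) (trans (g≈𝟘 n) (𝟘-coeff n))) (sym (𝟘-coeff n))

⊖-≈𝟘 : ∀ {f} → f ≈ 𝟘 → ⊖ f ≈ 𝟘
⊖-≈𝟘 f≈𝟘 n = trans (cong -ℤ_ (trans (f≈𝟘 n) (𝟘-coeff n))) (sym (𝟘-coeff n))

-- Multiplication by X shifts coefficients up, so D n is determined by D 0, …, D (n - 1) and E n.
≈𝟘-by-contraction : ∀ D K E → E ≈ 𝟘 → D ≈ X ⊗ (K ⊗ D) ⊕ E → D ≈ 𝟘
≈𝟘-by-contraction D K E E≈𝟘 D≈ n = trans (vanishes n n ℕP.≤-refl) (sym (𝟘-coeff n))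
  where
  E≡0 : ∀ m → E m ≡ ℤ.+ 0
  E≡0 m = trans (E≈𝟘 m) (𝟘-coeff m)
  vanishes : ∀ n m → m ≤ n → D m ≡ ℤ.+ 0
  vanishes n zero _ = trans (D≈ 0) (trans (ℤP.+-identityˡ (E 0)) (E≡0 0))
  vanishes (suc n) (suc m) (s≤s m≤n) = begin
    D (suc m)
      ≡⟨ D≈ (suc m) ⟩
    (X ⊗ (K ⊗ D)) (suc m) +ℤ E (suc m)
      ≡⟨ cong₂ _+ℤ_ (X⊗-suc (K ⊗ D) m) (E≡0 (suc m)) ⟩
    sumUpTo (λ k → K k *ℤ D (m ∸ k)) m +ℤ ℤ.+ 0
      ≡⟨ ℤP.+-identityʳ _ ⟩
    sumUpTo (λ k → K k *ℤ D (m ∸ k)) m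
      ≡⟨ sumUpTo-zero _ m (λ k → trans (cong (K k *ℤ_) (earlier k)) (ℤP.*-zeroʳ (K k))) ⟩
    ℤ.+ 0 ∎
    where
    open ≡-Reasoning
    earlier : ∀ k → D (m ∸ k) ≡ ℤ.+ 0
    earlier k = vanishes n (m ∸ k) (ℕP.≤-trans (ℕP.m∸n≤m m k) m≤n)

Z L G : FPS
Z = toFPS (zc 2)
L = toFPS (zc 1)
G = toFPS (zc 0)

Z-equation : Z ≈ recurrenceRHS X Z (L ⊖ 𝟙) (L ⊖ 𝟙)
Z-equation = zc-equation 2 ℕP.≤-refl (L ⊖ 𝟙) (λ j → trans (cong ℤ.+_ (ℕP.+-identityʳ _)) (toFPS-positivePart (zc 1) refl j))

L-equation : L ≈ recurrenceRHS X L (L ⊖ 𝟙) (G ⊖ 𝟙)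
L-equation = zc-equation 1 (s≤s z≤n) (G ⊖ 𝟙) (λ j → trans (cong ℤ.+_ (ℕP.+-identityʳ _)) (toFPS-positivePart (zc 0) refl j))

G-equation : G ≈ recurrenceRHS X G (L ⊖ 𝟙) 𝟘
G-equation = zc-equation 0 z≤n 𝟘 (λ j → sym (𝟘-coeff j))

G-identity : ∀ x z l g → g ⊖ (𝟙 ⊕ x ⊗ z)
  ≈ x ⊗ ((𝟙 ⊕ (l ⊖ 𝟙) ⊕ (l ⊖ 𝟙) ⊗ (l ⊖ 𝟙)) ⊗ (g ⊖ (𝟙 ⊕ x ⊗ z)))
    ⊕ ((g ⊖ recurrenceRHS x g (l ⊖ 𝟙) 𝟘) ⊖ (z ⊖ recurrenceRHS x z (l ⊖ 𝟙) (l ⊖ 𝟙)) ⊗ x)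
G-identity = solve 4 (λ x z l g → g :- (1ᴾ :+ x :* z)
  := x :* ((1ᴾ :+ (l :- 1ᴾ) :+ (l :- 1ᴾ) :* (l :- 1ᴾ)) :* (g :- (1ᴾ :+ x :* z)))
     :+ ((g :- recurrenceRHSᴾ x g (l :- 1ᴾ) (con (ℤ.+ 0))) :- (z :- recurrenceRHSᴾ x z (l :- 1ᴾ) (l :- 1ᴾ)) :* x)) (λ _ → refl)
  where
  1ᴾ : Polynomial 4
  1ᴾ = con (ℤ.+ 1)

-- Vertex 1 of capacity 0 is isolated: G = 1 + X Z.
G-isolated : G ⊖ (𝟙 ⊕ X ⊗ Z) ≈ 𝟘
G-isolated = ≈𝟘-by-contraction _ (𝟙 ⊕ (L ⊖ 𝟙) ⊕ (L ⊖ 𝟙) ⊗ (L ⊖ 𝟙)) _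
  (⊕-≈𝟘 (≈⇒⊖≈𝟘 G-equation) (⊖-≈𝟘 (⊗-zeroˡ X (≈⇒⊖≈𝟘 Z-equation))))
  (G-identity X Z L G)

L-identity : ∀ x z l g → (l ⊖ 𝟙) ⊖ x ⊗ z ⊗ l
  ≈ x ⊗ ((l ⊗ (l ⊖ 𝟙)) ⊗ ((l ⊖ 𝟙) ⊖ x ⊗ z ⊗ l))
    ⊕ ((l ⊖ recurrenceRHS x l (l ⊖ 𝟙) (g ⊖ 𝟙)) ⊕ (g ⊖ (𝟙 ⊕ x ⊗ z)) ⊗ (x ⊗ l) ⊖ (z ⊖ recurrenceRHS x z (l ⊖ 𝟙) (l ⊖ 𝟙)) ⊗ (x ⊗ l))
L-identity = solve 4 (λ x z l g → (l :- 1ᴾ) :- x :* z :* l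
  := x :* ((l :* (l :- 1ᴾ)) :* ((l :- 1ᴾ) :- x :* z :* l))
     :+ ((l :- recurrenceRHSᴾ x l (l :- 1ᴾ) (g :- 1ᴾ)) :+ (g :- (1ᴾ :+ x :* z)) :* (x :* l) :-
         (z :- recurrenceRHSᴾ x z (l :- 1ᴾ) (l :- 1ᴾ)) :* (x :* l))) (λ _ → refl)
  where
  1ᴾ : Polynomial 4
  1ᴾ = con (ℤ.+ 1)

L-closed : (L ⊖ 𝟙) ⊖ X ⊗ Z ⊗ L ≈ 𝟘
L-closed = ≈𝟘-by-contraction _ (L ⊗ (L ⊖ 𝟙)) _
  (⊕-≈𝟘 (⊕-≈𝟘 (≈⇒⊖≈𝟘 L-equation) (⊗-zeroˡ (X ⊗ L) G-isolated)) (⊖-≈𝟘 (⊗-zeroˡ (X ⊗ L) (≈⇒⊖≈𝟘 Z-equation))))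
  (L-identity X Z L G)

cubic : FPS → FPS → FPS
cubic x z = (x ⊗ x ⊗ (x ⊖ 𝟙) ⊗ z ⊗ z ⊗ z) ⊕ (const (ℤ.+ 2) ⊗ x ⊗ z ⊗ z) ⊖ ((x ⊕ 𝟙) ⊗ z) ⊕ 𝟙

cubic-identity : ∀ x z l → cubic x z
  ≈ ⊖ ((z ⊖ recurrenceRHS x z (l ⊖ 𝟙) (l ⊖ 𝟙)) ⊗ ((𝟙 ⊖ x ⊗ z) ⊗ (𝟙 ⊖ x ⊗ z))
       ⊕ ((l ⊖ 𝟙) ⊖ x ⊗ z ⊗ l) ⊗ (x ⊗ z ⊗ (𝟙 ⊖ x ⊗ z) ⊕ const (ℤ.+ 2) ⊗ (x ⊗ z) ⊗ (x ⊗ z) ⊕ x ⊗ z ⊗ ((l ⊖ 𝟙) ⊖ x ⊗ z ⊗ l)))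
cubic-identity = solve 3 (λ x z l →
  (x :* x :* (x :- 1ᴾ) :* z :* z :* z) :+ (con (ℤ.+ 2) :* x :* z :* z) :- ((x :+ 1ᴾ) :* z) :+ 1ᴾ
  := :- ((z :- recurrenceRHSᴾ x z (l :- 1ᴾ) (l :- 1ᴾ)) :* ((1ᴾ :- x :* z) :* (1ᴾ :- x :* z))
         :+ ((l :- 1ᴾ) :- x :* z :* l) :* (x :* z :* (1ᴾ :- x :* z) :+ con (ℤ.+ 2) :* (x :* z) :* (x :* z) :+ x :* z :* ((l :- 1ᴾ) :- x :* z :* l)))) (λ _ → refl)
  where
  1ᴾ : Polynomial 3
  1ᴾ = con (ℤ.+ 1)

cubic-Z : cubic X Z ≈ 𝟘
cubic-Z = ≈-trans (cubic-identity X Z L) (⊖-≈𝟘 (⊕-≈𝟘 (⊗-zeroˡ ((𝟙 ⊖ X ⊗ Z) ⊗ (𝟙 ⊖ X ⊗ Z)) (≈⇒⊖≈𝟘 Z-equation))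
                                                   (⊗-zeroˡ (X ⊗ Z ⊗ (𝟙 ⊖ X ⊗ Z) ⊕ const (ℤ.+ 2) ⊗ (X ⊗ Z) ⊗ (X ⊗ Z) ⊕ X ⊗ Z ⊗ ((L ⊖ 𝟙) ⊖ X ⊗ Z ⊗ L)) L-closed)))
  where open IsEquivalence ≈-isEquivalence renaming (trans to ≈-trans)

cubic-cong : ∀ {z z′} → z ≈ z′ → cubic X z ≈ cubic X z′
cubic-cong {z} {z′} z≈z′ n = cong₂ _+ℤ_ (cong₂ _+ℤ_ (cong₂ _+ℤ_ (cube n) (square n)) (cong -ℤ_ (linear n))) refl
  where
  times : ∀ f {f′} → f ≈ f′ → f ⊗ z ≈ f′ ⊗ z′
  times f {f′} f≈f′ = ⊗-cong {f} {f′} {z} {z′} f≈f′ z≈z′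
  cube : X ⊗ X ⊗ (X ⊖ 𝟙) ⊗ z ⊗ z ⊗ z ≈ X ⊗ X ⊗ (X ⊖ 𝟙) ⊗ z′ ⊗ z′ ⊗ z′
  cube = times (X ⊗ X ⊗ (X ⊖ 𝟙) ⊗ z ⊗ z) (times (X ⊗ X ⊗ (X ⊖ 𝟙) ⊗ z) (times (X ⊗ X ⊗ (X ⊖ 𝟙)) (λ _ → refl)))
  square : const (ℤ.+ 2) ⊗ X ⊗ z ⊗ z ≈ const (ℤ.+ 2) ⊗ X ⊗ z′ ⊗ z′
  square = times (const (ℤ.+ 2) ⊗ X ⊗ z) (times (const (ℤ.+ 2) ⊗ X) (λ _ → refl))
  linear : (X ⊕ 𝟙) ⊗ z ≈ (X ⊕ 𝟙) ⊗ z′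
  linear = times (X ⊕ 𝟙) (λ _ → refl)

Zser≈Z : Zser ≈ Z
Zser≈Z zero = refl
Zser≈Z (suc n) = cong ℤ.+_ (count-cong (subsets (allArcs (suc n))) (λ D → cong (isStackᵇ D ∧_)
  (all-cong′ (range 1 (suc n)) (λ v → cong (λ t → (deg D v ≤ᵇ t) ∧ not ((0 <ᵇ ld D v) ∧ (0 <ᵇ rd D v))) (sym (cap₁-2 v))))))
  where
  cap₁-2 : ∀ v → cap₁ 2 v ≡ 2
  cap₁-2 v with v ≡ᵇ 1
  ... | true = refl
  ... | false = refl

-- Opened only here: in scope earlier, ℤ's +_ would make sections such as (x +_) ambiguous.
open import Data.Integer using (+_)

mainTheorem4 : (n : ℕ) →
    ((X ⊗ X ⊗ (X ⊖ 𝟙) ⊗ Zser ⊗ Zser ⊗ Zser) ⊕ (const (+ 2) ⊗ X ⊗ Zser ⊗ Zser)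
    ⊖ ((X ⊕ 𝟙) ⊗ Zser) ⊕ 𝟙) n ≡ 𝟘 n
mainTheorem4 n = trans (cubic-cong Zser≈Z n) (cubic-Z n)
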